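{- Let $p$ be an odd prime, $g$ a primitive root modulo $p$, $d$ a positive divisor of $p-1$, $k=(p-1)/d$, $e_p(x)=e^{2\pi i x/p}$, $\eta_a=\sum_{j=0}^{k-1}e_p(g^{dj+a})$, $V_4(p)=\sum_{s=0}^{d-1}|\eta_s|^4$, and $\Gamma=\langle g^d\rangle$. For $0\le m,n\le d-1$ let $c_{0,m,n}$ be the number of $(a,b)\in\Gamma\times\Gamma$ with $a+g^mb=g^n$. Then (a) $\displaystyle V_4(p)=p\Big(\frac{p-1}{d}\Big)+p\sum_{l=0}^{d-1}c_{0,l,0}^2-\Big(\frac{p-1}{d}\Big)^3$, and (b) $\displaystyle V_4(p)=p\Big(\frac{p-1}{d}\Big)\delta_\alpha+p\sum_{l=0}^{d-1}c_{0,0,l}^2-\Big(\frac{p-1}{d}\Big)^3$, where $\delta_\alpha=1$ if $2d\mid(p-1)$ and $\delta_\alpha=0$ otherwise. -}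

module Defs where

open import Data.Nat as ℕ using (ℕ; zero; suc; NonZero; _∸_; _^_; _≡ᵇ_; _<_)
open import Data.Nat.DivMod using (_%_; _/_; _mod_)
open import Data.Integer as ℤ using (ℤ; +_; _+_; _*_; _-_)
open import Data.Fin using (Fin; toℕ)
open import Data.List using (List; map; foldr; upTo; allFin; length; filter; cartesianProduct)
open import Data.Bool using (if_then_else_)
open import Data.Product using (_×_; _,_; ∃)
open import Relation.Binary.PropositionalEquality using (_≡_; _≢_)

-- Model of the ring ℤ[ζ_p] ⊂ ℂ  (ζ_p = e^{2πi/p}).
-- Elements of the group ring ℤ[x]/(x^p - 1) are coefficient functions
-- Fin p → ℤ (coefficient of x^r).  ℤ[ζ_p] ≅ ℤ[x]/(x^p - 1, 1+x+…+x^{p-1}),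
-- and the ideal generated by 1+x+…+x^{p-1} in ℤ[x]/(x^p-1) consists exactly
-- of the constant coefficient vectors.  So two elements are equal in
-- ℤ[ζ_p] (equivalently, as complex numbers) iff their coefficient
-- vectors differ by a constant vector.  e_p(x) is the class of x^(x mod p).

Cyc : ℕ → Set
Cyc p = Fin p → ℤ

sumℤ : List ℤ → ℤ
sumℤ = foldr _+_ (+ 0)

module _ (p : ℕ) .{{_ : NonZero p}} where

  ep : ℕ → Cyc p
  ep x r = if toℕ r ≡ᵇ (x % p) then + 1 else + 0

  zeroC : Cyc p
  zeroC r = + 0

  addC : Cyc p → Cyc p → Cyc p
  addC f h r = f r + h r

  mulC : Cyc p → Cyc p → Cyc p
  mulC f h r = sumℤ (map (λ i → sumℤ (map (λ j →
      if ((toℕ i ℕ.+ toℕ j) % p) ≡ᵇ toℕ r then f i * h j else + 0)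
      (allFin p))) (allFin p))

  -- complex conjugation: ζ ↦ ζ⁻¹
  conjC : Cyc p → Cyc p
  conjC f r = f ((p ∸ toℕ r) mod p)

  sumC : List (Cyc p) → Cyc p
  sumC = foldr addC zeroC

  constC : ℤ → Cyc p
  constC n r = n * ep 0 r

  _≈C_ : Cyc p → Cyc p → Set
  f ≈C h = ∃ λ (c : ℤ) → ∀ r → f r ≡ h r + c

  abs4 : Cyc p → Cyc p
  abs4 z = let t = mulC z (conjC z) in mulC t t

-- g is a primitive root mod p: g is invertible mod p and has
-- multiplicative order exactly p - 1 (g^{p-1} ≡ 1 by Fermat).
IsPrimitiveRoot : (p g : ℕ) .{{_ : NonZero p}} → Set
IsPrimitiveRoot p g =
  (g % p ≢ 0) × (∀ i → 0 < i → i < p ∸ 1 → (g ^ i) % p ≢ 1)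

module _ (p g d : ℕ) .{{_ : NonZero p}} .{{_ : NonZero d}} where

  k : ℕ
  k = (p ∸ 1) / d

  η : ℕ → Cyc p
  η a = sumC p (map (λ j → ep p (g ^ (d ℕ.* j ℕ.+ a))) (upTo k))

  V4 : Cyc p
  V4 = sumC p (map (λ s → abs4 p (η s)) (upTo d))

  Γ : List ℕ
  Γ = map (λ j → (g ^ (d ℕ.* j)) % p) (upTo k)

  c0 : ℕ → ℕ → ℕ
  c0 m n = length (filter (λ ab → ((Data.Product.proj₁ ab ℕ.+ g ^ m ℕ.* Data.Product.proj₂ ab) % p)
                                   ℕ.≟ ((g ^ n) % p))
                          (cartesianProduct Γ Γ))
    where import Data.Product

  sumNℤ : (ℕ → ℕ) → ℕ → ℤ
  sumNℤ f n = sumℤ (map (λ l → + f l) (upTo n))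

  δα : ℤ
  δα = if Relation.Nullary.Decidable.⌊ (2 ℕ.* d) Data.Nat.Divisibility.∣? (p ∸ 1) ⌋ then + 1 else + 0
    where import Relation.Nullary.Decidable
          import Data.Nat.Divisibility

  rhsA : ℤ
  rhsA = (+ p) * (+ k) + (+ p) * sumNℤ (λ l → c0 l 0 ℕ.^ 2) d - (+ k) ℤ.^ 3

  rhsB : ℤ
  rhsB = (+ p) * (+ k) * δα + (+ p) * sumNℤ (λ l → c0 0 l ℕ.^ 2) d - (+ k) ℤ.^ 3

-- The coefficient of x^ρ in V₄ = Σ_s |η_s|⁴ is the number N(ρ) of solutions of
-- x₁ − x₂ + x₃ − x₄ ≡ ρ with x₁, …, x₄ in a common coset g^s Γ. Multiplication by g permutes
-- the cosets, so N is constant on the units, and counting all solutions gives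
-- N(0) + (p − 1) N(1) = d K⁴. As N(0) = d E for the additive energy E of Γ, V₄ equals the
-- integer N(0) − N(1) = p E / K − K³ in ℤ[ζ_p]. The two formulas are two evaluations of E:
-- (b) E = Σ_w r(w)² with r(w) = #{(a, b) ∈ Γ² : a + b = w}, grouped by the coset of w, where
--     r(0) = K δ_α because −1 = g^((p−1)/2) lies in Γ iff 2d ∣ p − 1;
-- (a) E = K · #{x + y = 1 + z} after scaling by an element of Γ, and parametrising the units
--     as g^l Γ turns this count into K + Σ_l c_{0,l,0}².

module Submission where

open import Data.Nat as ℕ
  using (ℕ; zero; suc; z≤n; s≤s; NonZero; >-nonZero; nonTrivial⇒n>1; _∸_; _%_; _/_; _≤_; _<_; _^_)
import Data.Nat.Properties as ℕ
open import Data.Integer as ℤ using (ℤ; +_; _+_; _*_; _-_)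
open import Data.Integer.Properties
  using (+-comm; +-assoc; +-identityˡ; +-identityʳ; *-comm; *-assoc; *-zeroˡ; *-zeroʳ; *-identityˡ; *-identityʳ;
         *-distribˡ-+; *-cancelˡ-≡; pos-+; pos-*; +-0-abelianGroup)
open import Algebra.Properties.AbelianGroup +-0-abelianGroup using (∙-cancelˡ)
open import Data.Integer.Tactic.RingSolver using (solve-∀)
open import Data.Nat.Tactic.RingSolver using () renaming (solve-∀ to ℕ-solve-∀)
open import Data.List
  using (List; []; _∷_; map; upTo; applyUpTo; _++_; concatMap; allFin; tabulate; length; filter; cartesianProduct)
open import Data.Fin as Fin using (Fin; toℕ; fromℕ<; punchOut) renaming (zero to fzero; suc to fsuc)
open import Data.Fin.Properties using (any?; injective⇒≤; punchOut-injective; toℕ-fromℕ<; toℕ-injective; toℕ<n)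
open import Data.Product using (_×_; _,_; proj₁; proj₂; ∃)
open import Function.Definitions using (Injective)
open import Function using (_∘_)
open import Relation.Binary.PropositionalEquality
open import Relation.Nullary using (¬_; Dec; yes; no; contradiction)
open import Relation.Nullary.Decidable using (⌊_⌋)
open import Data.Bool using (Bool; true; false; if_then_else_; T)
open import Data.Nat.DivMod
  using (_mod_; m%n<n; m%n%n≡m%n; m*n%n≡0; m<n⇒m%n≡m; n%n≡0; %-distribˡ-+; %-distribˡ-*; m≡m%n+[m/n]*n; m*[n/m]≡n)
open import Data.Nat.Divisibility using (_∣_; _∣?_; _∣0; divides; *-cancelˡ-∣; *-monoʳ-∣; m%n≡0⇒n∣m; n∣m⇒m%n≡0)
open import Data.Nat.Primality using (Prime; euclidsLemma; prime⇒nonTrivial; prime⇒irreducible)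
open import Data.Sum using (_⊎_; inj₁; inj₂)
import Data.Sum as ⊎
open import Defs

-- Finite sums

∑ : ℕ → (ℕ → ℤ) → ℤ
∑ zero    f = + 0
∑ (suc n) f = f 0 + ∑ n (f ∘ suc)

infix 6.5 ∑
syntax ∑ n (λ i → e) = ∑[ i < n ] e

∑-cong-< : ∀ n {f h : ℕ → ℤ} → (∀ i → i < n → f i ≡ h i) → ∑ n f ≡ ∑ n h
∑-cong-< zero    eq = refl
∑-cong-< (suc n) eq = cong₂ _+_ (eq 0 (s≤s z≤n)) (∑-cong-< n (λ i i<n → eq (suc i) (s≤s i<n)))

∑-cong : ∀ n {f h : ℕ → ℤ} → (∀ i → f i ≡ h i) → ∑ n f ≡ ∑ n h
∑-cong n eq = ∑-cong-< n (λ i _ → eq i)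

∑-zero : ∀ n {f : ℕ → ℤ} → (∀ i → i < n → f i ≡ + 0) → ∑ n f ≡ + 0
∑-zero zero    eq = refl
∑-zero (suc n) eq = cong₂ _+_ (eq 0 (s≤s z≤n)) (∑-zero n (λ i i<n → eq (suc i) (s≤s i<n)))

∑-single : ∀ n (f : ℕ → ℤ) u → u < n → (∀ i → i < n → i ≢ u → f i ≡ + 0) → ∑ n f ≡ f u
∑-single (suc n) f zero    _         eq =
  trans (cong (_+_ (f 0)) (∑-zero n (λ i i<n → eq (suc i) (s≤s i<n) λ ()))) (+-identityʳ (f 0))
∑-single (suc n) f (suc u) (s≤s u<n) eq =
  trans (cong₂ _+_ (eq 0 (s≤s z≤n) λ ())
                   (∑-single n (f ∘ suc) u u<n (λ i i<n i≢u → eq (suc i) (s≤s i<n) (i≢u ∘ ℕ.suc-injective))))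
        (+-identityˡ (f (suc u)))

∑-distrib-+ : ∀ n (f h : ℕ → ℤ) → ∑[ i < n ] (f i + h i) ≡ ∑ n f + ∑ n h
∑-distrib-+ zero    f h = refl
∑-distrib-+ (suc n) f h =
  trans (cong (_+_ (f 0 + h 0)) (∑-distrib-+ n (f ∘ suc) (h ∘ suc))) (interchange (f 0) (h 0) _ _)
  where interchange : ∀ a b c e → (a + b) + (c + e) ≡ (a + c) + (b + e)
        interchange = solve-∀

∑-distrib-- : ∀ n (f h : ℕ → ℤ) → ∑[ i < n ] (f i - h i) ≡ ∑ n f - ∑ n h
∑-distrib-- zero    f h = refl
∑-distrib-- (suc n) f h =
  trans (cong (_+_ (f 0 - h 0)) (∑-distrib-- n (f ∘ suc) (h ∘ suc))) (interchange (f 0) (h 0) _ _)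
  where interchange : ∀ a b c e → (a - b) + (c - e) ≡ (a + c) - (b + e)
        interchange = solve-∀

∑-*ˡ : ∀ n c (f : ℕ → ℤ) → ∑[ i < n ] (c * f i) ≡ c * ∑ n f
∑-*ˡ zero    c f = sym (*-zeroʳ c)
∑-*ˡ (suc n) c f = trans (cong (_+_ (c * f 0)) (∑-*ˡ n c (f ∘ suc))) (sym (*-distribˡ-+ c (f 0) _))

∑-*ʳ : ∀ n c (f : ℕ → ℤ) → ∑[ i < n ] (f i * c) ≡ ∑ n f * c
∑-*ʳ n c f = trans (∑-cong n (λ i → *-comm (f i) c)) (trans (∑-*ˡ n c f) (*-comm c _))

∑-const : ∀ n c → ∑[ _ < n ] c ≡ + n * c
∑-const zero    c = sym (*-zeroˡ c)
∑-const (suc n) c = trans (cong (_+_ c) (∑-const n c)) (sym (suc-* c (+ n)))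
  where suc-* : ∀ c m → (+ 1 + m) * c ≡ c + m * c
        suc-* = solve-∀

∑-comm : ∀ m n (f : ℕ → ℕ → ℤ) → ∑[ i < m ] ∑[ j < n ] f i j ≡ ∑[ j < n ] ∑[ i < m ] f i j
∑-comm zero    n f = sym (∑-zero n (λ _ _ → refl))
∑-comm (suc m) n f = trans (cong (_+_ (∑ n (f 0))) (∑-comm m n (f ∘ suc)))
                           (sym (∑-distrib-+ n (f 0) (λ j → ∑[ i < m ] f (suc i) j)))

∑-sucʳ : ∀ n (f : ℕ → ℤ) → ∑ (suc n) f ≡ ∑ n f + f n
∑-sucʳ zero    f = +-comm (f 0) (+ 0)
∑-sucʳ (suc n) f = trans (cong (_+_ (f 0)) (∑-sucʳ n (f ∘ suc))) (sym (+-assoc (f 0) _ _))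

∑-split : ∀ m n (f : ℕ → ℤ) → ∑ (m ℕ.+ n) f ≡ ∑ m f + ∑[ i < n ] f (m ℕ.+ i)
∑-split zero    n f = sym (+-identityˡ _)
∑-split (suc m) n f = trans (cong (_+_ (f 0)) (∑-split m n (f ∘ suc))) (sym (+-assoc (f 0) _ _))

∑-blocks : ∀ d k (f : ℕ → ℤ) → ∑ (d ℕ.* k) f ≡ ∑[ q < k ] ∑[ l < d ] f (q ℕ.* d ℕ.+ l)
∑-blocks d zero    f rewrite ℕ.*-zeroʳ d = refl
∑-blocks d (suc k) f rewrite ℕ.*-suc d k =
  trans (∑-split d (d ℕ.* k) f)
        (cong (_+_ (∑ d f)) (trans (∑-blocks d k (λ i → f (d ℕ.+ i)))
                                (∑-cong k (λ q → ∑-cong d (λ l → cong f (sym (ℕ.+-assoc d (q ℕ.* d) l)))))))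

∑-rotate : ∀ n (f : ℕ → ℤ) → f n ≡ f 0 → ∑[ i < n ] f (suc i) ≡ ∑ n f
∑-rotate n f fn≡f0 = ∙-cancelˡ (f 0) _ _ (begin
  f 0 + ∑[ i < n ] f (suc i)  ≡⟨ ∑-sucʳ n f ⟩
  ∑ n f + f n                 ≡⟨ cong (_+_ (∑ n f)) fn≡f0 ⟩
  ∑ n f + f 0                 ≡⟨ +-comm (∑ n f) (f 0) ⟩
  f 0 + ∑ n f                 ∎)
  where open ≡-Reasoning

∑-shift : ∀ n (f : ℕ → ℤ) → (∀ i → f (i ℕ.+ n) ≡ f i) → ∀ m → ∑[ i < n ] f (i ℕ.+ m) ≡ ∑ n f
∑-shift n f periodic zero    = ∑-cong n (λ i → cong f (ℕ.+-identityʳ i))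
∑-shift n f periodic (suc m) =
  trans (∑-cong n (λ i → cong f (ℕ.+-suc i m)))
        (trans (∑-rotate n (λ i → f (i ℕ.+ m)) (trans (cong f (ℕ.+-comm n m)) (periodic m)))
               (∑-shift n f periodic m))

∑² : ℕ → (ℕ → ℕ → ℤ) → ℤ
∑² n f = ∑[ i < n ] ∑[ j < n ] f i j

∑⁴ : ℕ → (ℕ → ℕ → ℕ → ℕ → ℤ) → ℤ
∑⁴ n f = ∑[ a < n ] ∑[ b < n ] ∑[ c < n ] ∑[ e < n ] f a b c e

∑²-cong : ∀ n {f h : ℕ → ℕ → ℤ} → (∀ i j → f i j ≡ h i j) → ∑² n f ≡ ∑² n h
∑²-cong n eq = ∑-cong n (λ i → ∑-cong n (eq i))

∑⁴-cong : ∀ n {f h : ℕ → ℕ → ℕ → ℕ → ℤ} → (∀ a b c e → f a b c e ≡ h a b c e) → ∑⁴ n f ≡ ∑⁴ n h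
∑⁴-cong n eq = ∑-cong n (λ a → ∑-cong n (λ b → ∑-cong n (λ c → ∑-cong n (eq a b c))))

∑⁴-const : ∀ n c → ∑⁴ n (λ _ _ _ _ → c) ≡ + n * (+ n * (+ n * (+ n * c)))
∑⁴-const n c =
  trans (∑-cong n (λ _ → trans (∑-cong n (λ _ → trans (∑-cong n (λ _ → ∑-const n c)) (∑-const n _))) (∑-const n _)))
        (∑-const n _)

∑⁴-∑-comm : ∀ n m (f : ℕ → ℕ → ℕ → ℕ → ℕ → ℤ) →
            ∑⁴ n (λ a b c e → ∑ m (f a b c e)) ≡ ∑[ w < m ] ∑⁴ n (λ a b c e → f a b c e w)
∑⁴-∑-comm n m f =
  trans (∑-cong n λ a → ∑-cong n λ b → ∑-cong n λ c → ∑-comm n m (λ e w → f a b c e w))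
  (trans (∑-cong n λ a → ∑-cong n λ b → ∑-comm n m (λ c w → ∑[ e < n ] f a b c e w))
  (trans (∑-cong n λ a → ∑-comm n m (λ b w → ∑[ c < n ] ∑[ e < n ] f a b c e w))
         (∑-comm n m (λ a w → ∑[ b < n ] ∑[ c < n ] ∑[ e < n ] f a b c e w))))

∑²-product : ∀ n (f h : ℕ → ℤ) → ∑² n (λ i j → f i * h j) ≡ ∑ n f * ∑ n h
∑²-product n f h = trans (∑-cong n (λ i → ∑-*ˡ n (f i) h)) (∑-*ʳ n (∑ n h) f)

∑⁴-product : ∀ n (f h : ℕ → ℕ → ℤ) → ∑⁴ n (λ a b c e → f a c * h b e) ≡ ∑² n f * ∑² n h
∑⁴-product n f h =
  trans (∑-cong n λ a → ∑-cong n λ b → ∑-cong n λ c → ∑-*ˡ n (f a c) (h b))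
  (trans (∑-cong n λ a → ∑-cong n λ b → ∑-*ʳ n (∑ n (h b)) (f a))
  (trans (∑-cong n λ a → ∑-*ˡ n (∑ n (f a)) (λ b → ∑ n (h b)))
         (∑-*ʳ n (∑² n h) (λ a → ∑ n (f a)))))

∑⁴-rotate : ∀ n (f : ℕ → ℕ → ℕ → ℕ → ℤ) →
            (∀ b c e → f n b c e ≡ f 0 b c e) → (∀ a c e → f a n c e ≡ f a 0 c e) →
            (∀ a b e → f a b n e ≡ f a b 0 e) → (∀ a b c → f a b c n ≡ f a b c 0) →
            ∑⁴ n (λ a b c e → f (suc a) (suc b) (suc c) (suc e)) ≡ ∑⁴ n f
∑⁴-rotate n f f₁ f₂ f₃ f₄ =
  trans (∑-cong n λ a → ∑-cong n λ b → ∑-cong n λ c → ∑-rotate n (f (suc a) (suc b) (suc c)) (f₄ _ _ _))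
  (trans (∑-cong n λ a → ∑-cong n λ b → ∑-rotate n (λ c → ∑ n (f (suc a) (suc b) c)) (∑-cong n (f₃ _ _)))
  (trans (∑-cong n λ a → ∑-rotate n (λ b → ∑[ c < n ] ∑ n (f (suc a) b c)) (∑-cong n λ c → ∑-cong n (f₂ _ c)))
         (∑-rotate n (λ a → ∑[ b < n ] ∑[ c < n ] ∑ n (f a b c)) (∑-cong n λ b → ∑-cong n λ c → ∑-cong n (f₁ b c)))))

∑ˡ : {A : Set} → List A → (A → ℤ) → ℤ
∑ˡ xs f = sumℤ (map f xs)

∑ˡ-cong : {A : Set} (xs : List A) {f h : A → ℤ} → (∀ x → f x ≡ h x) → ∑ˡ xs f ≡ ∑ˡ xs h
∑ˡ-cong []       eq = refl
∑ˡ-cong (x ∷ xs) eq = cong₂ _+_ (eq x) (∑ˡ-cong xs eq)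

∑ˡ-map : {A B : Set} (xs : List A) (h : A → B) (f : B → ℤ) → ∑ˡ (map h xs) f ≡ ∑ˡ xs (f ∘ h)
∑ˡ-map []       h f = refl
∑ˡ-map (x ∷ xs) h f = cong (_+_ (f (h x))) (∑ˡ-map xs h f)

∑ˡ-applyUpTo : ∀ n (h : ℕ → ℕ) (f : ℕ → ℤ) → ∑ˡ (applyUpTo h n) f ≡ ∑[ i < n ] f (h i)
∑ˡ-applyUpTo zero    h f = refl
∑ˡ-applyUpTo (suc n) h f = cong (_+_ (f (h 0))) (∑ˡ-applyUpTo n (h ∘ suc) f)

∑ˡ-upTo : ∀ n (f : ℕ → ℤ) → ∑ˡ (upTo n) f ≡ ∑ n f
∑ˡ-upTo n f = ∑ˡ-applyUpTo n (λ i → i) f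

∑ˡ-map-upTo : {B : Set} (n : ℕ) (h : ℕ → B) (f : B → ℤ) → ∑ˡ (map h (upTo n)) f ≡ ∑[ i < n ] f (h i)
∑ˡ-map-upTo n h f = trans (∑ˡ-map (upTo n) h f) (∑ˡ-upTo n (f ∘ h))

∑ˡ-tabulate : {B : Set} (n : ℕ) (h : Fin n → B) (f : B → ℤ) (f′ : ℕ → ℤ) → (∀ i → f (h i) ≡ f′ (toℕ i)) →
              ∑ˡ (tabulate h) f ≡ ∑ n f′
∑ˡ-tabulate zero    h f f′ eq = refl
∑ˡ-tabulate (suc n) h f f′ eq = cong₂ _+_ (eq fzero) (∑ˡ-tabulate n (h ∘ fsuc) f (f′ ∘ suc) (eq ∘ fsuc))

∑ˡ-allFin : ∀ n (f : Fin n → ℤ) (f′ : ℕ → ℤ) → (∀ i → f i ≡ f′ (toℕ i)) → ∑ˡ (allFin n) f ≡ ∑ n f′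
∑ˡ-allFin n f f′ = ∑ˡ-tabulate n (λ i → i) f f′

∑ˡ-++ : {A : Set} (xs ys : List A) (f : A → ℤ) → ∑ˡ (xs ++ ys) f ≡ ∑ˡ xs f + ∑ˡ ys f
∑ˡ-++ []       ys f = sym (+-identityˡ _)
∑ˡ-++ (x ∷ xs) ys f = trans (cong (_+_ (f x)) (∑ˡ-++ xs ys f)) (sym (+-assoc (f x) _ _))

∑ˡ-concatMap : {A B : Set} (xs : List A) (h : A → List B) (f : B → ℤ) →
               ∑ˡ (concatMap h xs) f ≡ ∑ˡ xs (λ x → ∑ˡ (h x) f)
∑ˡ-concatMap []       h f = refl
∑ˡ-concatMap (x ∷ xs) h f = trans (∑ˡ-++ (h x) (concatMap h xs) f) (cong (_+_ (∑ˡ (h x) f)) (∑ˡ-concatMap xs h f))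

∑ˡ-*ˡ : {A : Set} (xs : List A) (c : ℤ) (f : A → ℤ) → ∑ˡ xs (λ x → c * f x) ≡ c * ∑ˡ xs f
∑ˡ-*ˡ []       c f = sym (*-zeroʳ c)
∑ˡ-*ˡ (x ∷ xs) c f = trans (cong (_+_ (c * f x)) (∑ˡ-*ˡ xs c f)) (sym (*-distribˡ-+ c (f x) _))

∑ˡ-*ʳ : {A : Set} (xs : List A) (c : ℤ) (f : A → ℤ) → ∑ˡ xs (λ x → f x * c) ≡ ∑ˡ xs f * c
∑ˡ-*ʳ xs c f = trans (∑ˡ-cong xs (λ x → *-comm (f x) c)) (trans (∑ˡ-*ˡ xs c f) (*-comm c _))

∑ˡ-cartesianProduct : {A B : Set} (xs : List A) (ys : List B) (f : A × B → ℤ) →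
                      ∑ˡ (cartesianProduct xs ys) f ≡ ∑ˡ xs (λ x → ∑ˡ ys (λ y → f (x , y)))
∑ˡ-cartesianProduct []       ys f = refl
∑ˡ-cartesianProduct (x ∷ xs) ys f =
  trans (∑ˡ-++ (map (x ,_) ys) _ f) (cong₂ _+_ (∑ˡ-map ys (x ,_) f) (∑ˡ-cartesianProduct xs ys f))

∑ˡ-∑-comm : {A : Set} (xs : List A) (n : ℕ) (f : A → ℕ → ℤ) →
            ∑ˡ xs (λ x → ∑ n (f x)) ≡ ∑[ i < n ] ∑ˡ xs (λ x → f x i)
∑ˡ-∑-comm []       n f = sym (∑-zero n (λ _ _ → refl))
∑ˡ-∑-comm (x ∷ xs) n f = trans (cong (_+_ (∑ n (f x))) (∑ˡ-∑-comm xs n f)) (sym (∑-distrib-+ n (f x) _))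

-- Indicators and arithmetic modulo p

𝟙 : {P : Set} → Dec P → ℤ
𝟙 P? = if ⌊ P? ⌋ then + 1 else + 0

𝟙-yes : {P : Set} (P? : Dec P) → P → 𝟙 P? ≡ + 1
𝟙-yes (yes _) _  = refl
𝟙-yes (no ¬P) P  = contradiction P ¬P

𝟙-no : {P : Set} (P? : Dec P) → ¬ P → 𝟙 P? ≡ + 0
𝟙-no (yes P) ¬P = contradiction P ¬P
𝟙-no (no _)  _  = refl

𝟙-⇔ : {P Q : Set} (P? : Dec P) (Q? : Dec Q) → (P → Q) → (Q → P) → 𝟙 P? ≡ 𝟙 Q?
𝟙-⇔ (yes P) Q? P⇒Q _   = sym (𝟙-yes Q? (P⇒Q P))
𝟙-⇔ (no ¬P) Q? _   Q⇒P = sym (𝟙-no Q? (¬P ∘ Q⇒P))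

𝟙-idem : {P : Set} (P? : Dec P) → 𝟙 P? * 𝟙 P? ≡ 𝟙 P?
𝟙-idem (yes _) = refl
𝟙-idem (no _)  = refl

length-filter : {A : Set} {P : A → Set} (P? : ∀ x → Dec (P x)) (xs : List A) →
                + length (filter P? xs) ≡ ∑ˡ xs (𝟙 ∘ P?)
length-filter P? []       = refl
length-filter P? (x ∷ xs) with P? x
... | yes _ = cong (_+_ (+ 1)) (length-filter P? xs)
... | no _  = trans (length-filter P? xs) (sym (+-identityˡ _))

module Modulo (p : ℕ) .{{_ : NonZero p}} where

  infix 4 _≈_
  _≈_ : ℕ → ℕ → Set
  x ≈ y = x % p ≡ y % p

  ≈-refl : ∀ {x} → x ≈ x
  ≈-refl = refl

  ≈-sym : ∀ {x y} → x ≈ y → y ≈ x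
  ≈-sym = sym

  ≈-trans : ∀ {x y z} → x ≈ y → y ≈ z → x ≈ z
  ≈-trans = trans

  ≡⇒≈ : ∀ {x y} → x ≡ y → x ≈ y
  ≡⇒≈ = cong (_% p)

  %-≈ : ∀ x → x % p ≈ x
  %-≈ x = m%n%n≡m%n x p

  0%p≡0 : 0 % p ≡ 0
  0%p≡0 = m*n%n≡0 0 p

  p≈0 : p ≈ 0
  p≈0 = trans (n%n≡0 p) (sym 0%p≡0)

  +-cong : ∀ {a b c e} → a ≈ b → c ≈ e → a ℕ.+ c ≈ b ℕ.+ e
  +-cong {a} {b} {c} {e} a≈b c≈e =
    trans (%-distribˡ-+ a c p) (trans (cong₂ (λ u v → (u ℕ.+ v) % p) a≈b c≈e) (sym (%-distribˡ-+ b e p)))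

  *-cong : ∀ {a b c e} → a ≈ b → c ≈ e → a ℕ.* c ≈ b ℕ.* e
  *-cong {a} {b} {c} {e} a≈b c≈e =
    trans (%-distribˡ-* a c p) (trans (cong₂ (λ u v → (u ℕ.* v) % p) a≈b c≈e) (sym (%-distribˡ-* b e p)))

  +-≈0ʳ : ∀ {a z} → z ≈ 0 → a ℕ.+ z ≈ a
  +-≈0ʳ {a} z≈0 = ≈-trans (+-cong {a} ≈-refl z≈0) (≡⇒≈ (ℕ.+-identityʳ a))

  negate : ℕ → ℕ
  negate x = p ∸ x % p

  negate-inverse : ∀ x → negate x ℕ.+ x ≈ 0
  negate-inverse x = ≈-trans (+-cong {negate x} ≈-refl (≈-sym (%-≈ x)))
                             (≈-trans (≡⇒≈ (ℕ.m∸n+n≡m (ℕ.<⇒≤ (m%n<n x p)))) p≈0)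

  negate-cong : ∀ {x y} → x ≈ y → negate x ≡ negate y
  negate-cong = cong (p ∸_)

  +-cancelʳ : ∀ {a b} c → a ℕ.+ c ≈ b ℕ.+ c → a ≈ b
  +-cancelʳ {a} {b} c a+c≈b+c = ≈-trans (≈-sym (cancelled a)) (≈-trans (+-cong a+c≈b+c (≈-refl {negate c})) (cancelled b))
    where cancelled : ∀ x → (x ℕ.+ c) ℕ.+ negate c ≈ x
          cancelled x = ≈-trans (≡⇒≈ (trans (ℕ.+-assoc x c (negate c)) (cong (x ℕ.+_) (ℕ.+-comm c (negate c)))))
                                (+-≈0ʳ (negate-inverse c))

  +-≈0-unique : ∀ {a b c} → a ℕ.+ c ≈ 0 → b ℕ.+ c ≈ 0 → a ≈ b
  +-≈0-unique {c = c} a+c≈0 b+c≈0 = +-cancelʳ c (≈-trans a+c≈0 (≈-sym b+c≈0))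

  negate-* : ∀ c x → negate (c ℕ.* x) ≈ c ℕ.* negate x
  negate-* c x = +-≈0-unique (negate-inverse (c ℕ.* x))
    (≈-trans (≡⇒≈ (sym (ℕ.*-distribˡ-+ c (negate x) x)))
             (≈-trans (*-cong {c} ≈-refl (negate-inverse x)) (≡⇒≈ (ℕ.*-zeroʳ c))))

  ∑-0+units : ∀ (f : ℕ → ℤ) → ∑ p f ≡ f 0 + ∑[ i < p ∸ 1 ] f (suc i)
  ∑-0+units f = cong (λ n → ∑ n f) (sym (ℕ.suc-pred p))

  ≉0-<p : ∀ {x} → 0 < x → x < p → ¬ x ≈ 0
  ≉0-<p {x} 0<x x<p x≈0 = ℕ.<⇒≢ 0<x (sym (trans (sym (m<n⇒m%n≡m x<p)) (trans x≈0 0%p≡0)))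

  suc-<p∸1 : ∀ {i} → i < p ∸ 1 → suc i < p
  suc-<p∸1 {i} i<p∸1 = subst (suc i <_) (ℕ.suc-pred p) (s≤s i<p∸1)

  𝟙[_≈_] : ℕ → ℕ → ℤ
  𝟙[ x ≈ y ] = 𝟙 (x % p ℕ.≟ y % p)

  𝟙-≈ : ∀ {x y} → x ≈ y → 𝟙[ x ≈ y ] ≡ + 1
  𝟙-≈ {x} {y} = 𝟙-yes (x % p ℕ.≟ y % p)

  𝟙-≉ : ∀ {x y} → ¬ x ≈ y → 𝟙[ x ≈ y ] ≡ + 0
  𝟙-≉ {x} {y} = 𝟙-no (x % p ℕ.≟ y % p)

  𝟙-≈-⇔ : ∀ {x y x′ y′} → (x ≈ y → x′ ≈ y′) → (x′ ≈ y′ → x ≈ y) → 𝟙[ x ≈ y ] ≡ 𝟙[ x′ ≈ y′ ]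
  𝟙-≈-⇔ {x} {y} {x′} {y′} = 𝟙-⇔ (x % p ℕ.≟ y % p) (x′ % p ℕ.≟ y′ % p)

  𝟙-sym : ∀ x y → 𝟙[ x ≈ y ] ≡ 𝟙[ y ≈ x ]
  𝟙-sym x y = 𝟙-≈-⇔ sym sym

  𝟙-congˡ : ∀ {x x′ y} → x ≈ x′ → 𝟙[ x ≈ y ] ≡ 𝟙[ x′ ≈ y ]
  𝟙-congˡ x≈x′ = 𝟙-≈-⇔ (≈-trans (≈-sym x≈x′)) (≈-trans x≈x′)

  𝟙-congʳ : ∀ {x y y′} → y ≈ y′ → 𝟙[ x ≈ y ] ≡ 𝟙[ x ≈ y′ ]
  𝟙-congʳ y≈y′ = 𝟙-≈-⇔ (λ e → ≈-trans e y≈y′) (λ e → ≈-trans e (≈-sym y≈y′))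

  𝟙-+-solve : ∀ a w b → 𝟙[ a ℕ.+ w ≈ b ] ≡ 𝟙[ b ℕ.+ negate a ≈ w ]
  𝟙-+-solve a w b = 𝟙-≈-⇔ (λ a+w≈b → +-cancelʳ a (≈-trans cancelled (≈-trans (≈-sym a+w≈b) (≡⇒≈ (ℕ.+-comm a w)))))
                          (λ b-a≈w → ≈-trans (≈-trans (≡⇒≈ (ℕ.+-comm a w)) (+-cong (≈-sym b-a≈w) (≈-refl {a}))) cancelled)
    where cancelled : (b ℕ.+ negate a) ℕ.+ a ≈ b
          cancelled = ≈-trans (≡⇒≈ (ℕ.+-assoc b (negate a) a)) (+-≈0ʳ (negate-inverse a))

  ∑-𝟙-sift : ∀ x (f : ℕ → ℤ) → ∑[ i < p ] 𝟙[ x ≈ i ] * f i ≡ f (x % p)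
  ∑-𝟙-sift x f = trans (∑-single p _ (x % p) (m%n<n x p) off-diagonal) on-diagonal
    where
    off-diagonal : ∀ i → i < p → i ≢ x % p → 𝟙[ x ≈ i ] * f i ≡ + 0
    off-diagonal i i<p i≢x = trans (cong (_* f i) (𝟙-≉ (λ x≈i → i≢x (trans (sym (m<n⇒m%n≡m i<p)) (sym x≈i)))))
                                   (*-zeroˡ (f i))
    on-diagonal : 𝟙[ x ≈ x % p ] * f (x % p) ≡ f (x % p)
    on-diagonal = trans (cong (_* f (x % p)) (𝟙-≈ (≈-sym (%-≈ x)))) (*-identityˡ _)

  ∑-𝟙 : ∀ x → ∑[ i < p ] 𝟙[ x ≈ i ] ≡ + 1
  ∑-𝟙 x = trans (∑-cong p (λ i → sym (*-identityʳ 𝟙[ x ≈ i ]))) (∑-𝟙-sift x (λ _ → + 1))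

  𝟙-split : ∀ u v → 𝟙[ u ≈ v ] ≡ ∑[ w < p ] 𝟙[ u ≈ w ] * 𝟙[ v ≈ w ]
  𝟙-split u v = sym (trans (∑-𝟙-sift u (λ w → 𝟙[ v ≈ w ])) (trans (𝟙-congʳ (%-≈ u)) (𝟙-sym v u)))

  ≈0⇒∣ : ∀ {x} → x ≈ 0 → p ∣ x
  ≈0⇒∣ {x} x≈0 = m%n≡0⇒n∣m x p (trans x≈0 0%p≡0)

  ∣⇒≈0 : ∀ {x} → p ∣ x → x ≈ 0
  ∣⇒≈0 {x} p∣x = trans (n∣m⇒m%n≡0 x p p∣x) (sym 0%p≡0)

  ≈⇒∣∸ : ∀ {u v} → u ≈ v → p ∣ v ∸ u
  ≈⇒∣∸ {u} {v} u≈v = divides (v / p ∸ u / p) (begin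
    v ∸ u                                     ≡⟨ cong₂ _∸_ (m≡m%n+[m/n]*n v p) (m≡m%n+[m/n]*n u p) ⟩
    (v % p ℕ.+ v / p ℕ.* p) ∸ (u % p ℕ.+ u / p ℕ.* p)
      ≡⟨ cong (λ t → (v % p ℕ.+ v / p ℕ.* p) ∸ (t ℕ.+ u / p ℕ.* p)) u≈v ⟩
    (v % p ℕ.+ v / p ℕ.* p) ∸ (v % p ℕ.+ u / p ℕ.* p) ≡⟨ ℕ.[m+n]∸[m+o]≡n∸o (v % p) _ _ ⟩
    v / p ℕ.* p ∸ u / p ℕ.* p                  ≡⟨ ℕ.*-distribʳ-∸ p (v / p) (u / p) ⟨
    (v / p ∸ u / p) ℕ.* p                      ∎)
    where open ≡-Reasoning

  module Field (p-prime : Prime p) where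

    1<p : 1 < p
    1<p = nonTrivial⇒n>1 p {{prime⇒nonTrivial p-prime}}

    1%p≡1 : 1 % p ≡ 1
    1%p≡1 = m<n⇒m%n≡m 1<p

    1≉0 : ¬ 1 ≈ 0
    1≉0 1≈0 = ℕ.1+n≢0 (trans (sym 1%p≡1) (trans 1≈0 0%p≡0))

    *-≉0 : ∀ {a b} → ¬ a ≈ 0 → ¬ b ≈ 0 → ¬ a ℕ.* b ≈ 0
    *-≉0 {a} {b} a≉0 b≉0 ab≈0 with euclidsLemma a b p-prime (≈0⇒∣ ab≈0)
    ... | inj₁ p∣a = a≉0 (∣⇒≈0 p∣a)
    ... | inj₂ p∣b = b≉0 (∣⇒≈0 p∣b)

    private
      *-cancelˡ-≤ : ∀ c {a b} → ¬ c ≈ 0 → a ≤ b → b < p → c ℕ.* a ≈ c ℕ.* b → b ≤ a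
      *-cancelˡ-≤ c {a} {b} c≉0 a≤b b<p ca≈cb
        with euclidsLemma c (b ∸ a) p-prime (subst (p ∣_) (sym (ℕ.*-distribˡ-∸ c b a)) (≈⇒∣∸ ca≈cb))
      ... | inj₁ p∣c   = contradiction (∣⇒≈0 p∣c) c≉0
      ... | inj₂ p∣b∸a = ℕ.m∸n≡0⇒m≤n (trans (sym (m<n⇒m%n≡m (ℕ.≤-<-trans (ℕ.m∸n≤m b a) b<p)))
                                           (n∣m⇒m%n≡0 _ p p∣b∸a))

    *-cancelˡ : ∀ c {a b} → ¬ c ≈ 0 → c ℕ.* a ≈ c ℕ.* b → a ≈ b
    *-cancelˡ c {a} {b} c≉0 ca≈cb = cancel-reduced (ℕ.≤-total (a % p) (b % p))
      where
      reduced : c ℕ.* (a % p) ≈ c ℕ.* (b % p)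
      reduced = ≈-trans (*-cong {c} ≈-refl (%-≈ a)) (≈-trans ca≈cb (*-cong {c} ≈-refl (≈-sym (%-≈ b))))
      cancel-reduced : (a % p ≤ b % p) ⊎ (b % p ≤ a % p) → a ≈ b
      cancel-reduced (inj₁ a≤b) = ℕ.≤-antisym a≤b (*-cancelˡ-≤ c c≉0 a≤b (m%n<n b p) reduced)
      cancel-reduced (inj₂ b≤a) = sym (ℕ.≤-antisym b≤a (*-cancelˡ-≤ c c≉0 b≤a (m%n<n a p) (≈-sym reduced)))

    𝟙-*-cancelˡ : ∀ c {x y} → ¬ c ≈ 0 → 𝟙[ c ℕ.* x ≈ c ℕ.* y ] ≡ 𝟙[ x ≈ y ]
    𝟙-*-cancelˡ c c≉0 = 𝟙-≈-⇔ (*-cancelˡ c c≉0) (*-cong {c} ≈-refl)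

    square≈1 : ∀ x → x ℕ.* x ≈ 1 → x ≈ 1 ⊎ x ℕ.+ 1 ≈ 0
    square≈1 zero    0≈1  = contradiction (≈-sym 0≈1) 1≉0
    square≈1 (suc y) x²≈1 =
      ⊎.map (λ p∣y → +-≈0ʳ {1} (∣⇒≈0 p∣y)) (λ p∣2+y → ≈-trans (≡⇒≈ (ℕ.+-comm (suc y) 1)) (∣⇒≈0 p∣2+y))
            (euclidsLemma y (2 ℕ.+ y) p-prime (subst (p ∣_) (x²∸1 y) (≈⇒∣∸ (≈-sym x²≈1))))
      where
      -- x² − 1 = (x − 1)(x + 1) with x = 1 + y
      x²∸1 : ∀ y → y ℕ.+ y ℕ.* suc y ≡ y ℕ.* (2 ℕ.+ y)
      x²∸1 = ℕ-solve-∀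

-- Primitive roots

Fin-injective⇒surjective : ∀ {n} (f : Fin n → Fin n) → Injective _≡_ _≡_ f → ∀ y → ∃ λ x → f x ≡ y
Fin-injective⇒surjective {suc n} f f-injective y with any? (λ x → f x Fin.≟ y)
... | yes hit  = hit
... | no  miss = contradiction (injective⇒≤ punched-injective) ℕ.1+n≰n
  where
  punched : Fin (suc n) → Fin n
  punched x = punchOut {i = y} {j = f x} (λ y≡fx → miss (x , sym y≡fx))
  punched-injective : Injective _≡_ _≡_ punched
  punched-injective e = f-injective (punchOut-injective {i = y} _ _ e)

module PrimitiveRoot (p g : ℕ) .{{_ : NonZero p}} (p-prime : Prime p) (primRoot : IsPrimitiveRoot p g) where
  open Modulo p
  open Field p-prime

  g≉0 : ¬ g ≈ 0
  g≉0 g≈0 = proj₁ primRoot (trans g≈0 0%p≡0)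

  g^-≉0 : ∀ e → ¬ g ^ e ≈ 0
  g^-≉0 zero    = 1≉0
  g^-≉0 (suc e) = *-≉0 g≉0 (g^-≉0 e)

  g^-order : ∀ {i} → 0 < i → i < p ∸ 1 → ¬ g ^ i ≈ 1
  g^-order 0<i i<p∸1 g^i≈1 = proj₂ primRoot _ 0<i i<p∸1 (trans g^i≈1 1%p≡1)

  g^-cancel : ∀ {x y} → x ≤ y → g ^ x ≈ g ^ y → g ^ (y ∸ x) ≈ 1
  g^-cancel {x} {y} x≤y g^x≈g^y = ≈-sym (*-cancelˡ (g ^ x) (g^-≉0 x) (≈-trans (≡⇒≈ (ℕ.*-identityʳ (g ^ x)))
    (≈-trans g^x≈g^y (≡⇒≈ (trans (cong (g ^_) (sym (ℕ.m+[n∸m]≡n x≤y))) (ℕ.^-distribˡ-+-* g x (y ∸ x)))))))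

  private
    ^-injective-≤ : ∀ {x y} → x ≤ y → y < p ∸ 1 → g ^ x ≈ g ^ y → x ≡ y
    ^-injective-≤ {x} {y} x≤y y<p∸1 g^x≈g^y with ℕ.m≤n⇒m<n∨m≡n x≤y
    ... | inj₂ x≡y = x≡y
    ... | inj₁ x<y = contradiction (g^-cancel x≤y g^x≈g^y)
                                   (g^-order (ℕ.m<n⇒0<n∸m x<y) (ℕ.≤-<-trans (ℕ.m∸n≤m y x) y<p∸1))

  ^-injective : ∀ {x y} → x < p ∸ 1 → y < p ∸ 1 → g ^ x ≈ g ^ y → x ≡ y
  ^-injective {x} {y} x< y< g^x≈g^y with ℕ.≤-total x y
  ... | inj₁ x≤y = ^-injective-≤ x≤y y< g^x≈g^y
  ... | inj₂ y≤x = sym (^-injective-≤ y≤x x< (≈-sym g^x≈g^y))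

  private
    1≤%p : ∀ {x} → ¬ x ≈ 0 → 1 ≤ x % p
    1≤%p x≉0 = ℕ.n≢0⇒n>0 (λ x%p≡0 → x≉0 (trans x%p≡0 (sym 0%p≡0)))

    unitIndex : ∀ x → ¬ x ≈ 0 → Fin (p ∸ 1)
    unitIndex x x≉0 = fromℕ< (ℕ.∸-monoˡ-< (m%n<n x p) (1≤%p x≉0))

    unitIndex-injective : ∀ {x y} (x≉0 : ¬ x ≈ 0) (y≉0 : ¬ y ≈ 0) → unitIndex x x≉0 ≡ unitIndex y y≉0 → x ≈ y
    unitIndex-injective x≉0 y≉0 eq = ℕ.∸-cancelʳ-≡ (1≤%p x≉0) (1≤%p y≉0)
      (trans (sym (toℕ-fromℕ< _)) (trans (cong toℕ eq) (toℕ-fromℕ< _)))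

    powerIndex : Fin (p ∸ 1) → Fin (p ∸ 1)
    powerIndex i = unitIndex (g ^ toℕ i) (g^-≉0 (toℕ i))

    powerIndex-injective : Injective _≡_ _≡_ powerIndex
    powerIndex-injective {i} {j} eq =
      toℕ-injective (^-injective (toℕ<n i) (toℕ<n j) (unitIndex-injective (g^-≉0 (toℕ i)) (g^-≉0 (toℕ j)) eq))

  discreteLog : ∀ w → ¬ w ≈ 0 → ∃ λ e → e < p ∸ 1 × g ^ e ≈ w
  discreteLog w w≉0 with Fin-injective⇒surjective powerIndex powerIndex-injective (unitIndex w w≉0)
  ... | i , eq = toℕ i , toℕ<n i , unitIndex-injective (g^-≉0 (toℕ i)) w≉0 eq

  fermat : g ^ (p ∸ 1) ≈ 1
  fermat with discreteLog (g ^ (p ∸ 1)) (g^-≉0 (p ∸ 1))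
  ... | zero  , _     , 1≈g^[p∸1]    = ≈-sym 1≈g^[p∸1]
  ... | suc e , e<p∸1 , g^e≈g^[p∸1] = contradiction (g^-cancel (ℕ.<⇒≤ e<p∸1) g^e≈g^[p∸1])
                                        (g^-order (ℕ.m<n⇒0<n∸m e<p∸1) (ℕ.∸-monoʳ-< (s≤s z≤n) (ℕ.<⇒≤ e<p∸1)))

  g^-periodic : ∀ x → g ^ (x ℕ.+ (p ∸ 1)) ≈ g ^ x
  g^-periodic x = ≈-trans (≡⇒≈ (ℕ.^-distribˡ-+-* g x (p ∸ 1)))
                          (≈-trans (*-cong {g ^ x} ≈-refl fermat) (≡⇒≈ (ℕ.*-identityʳ (g ^ x))))

  logCount : ℕ → ℤ
  logCount w = ∑[ e < p ∸ 1 ] 𝟙[ g ^ e ≈ w ]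

  logCount-0 : logCount 0 ≡ + 0
  logCount-0 = ∑-zero (p ∸ 1) (λ e _ → 𝟙-≉ (g^-≉0 e))

  logCount-unit : ∀ {w} → ¬ w ≈ 0 → logCount w ≡ + 1
  logCount-unit {w} w≉0 with discreteLog w w≉0
  ... | e₀ , e₀< , g^e₀≈w = trans (∑-single (p ∸ 1) _ e₀ e₀< off-diagonal) (𝟙-≈ g^e₀≈w)
    where off-diagonal : ∀ e → e < p ∸ 1 → e ≢ e₀ → 𝟙[ g ^ e ≈ w ] ≡ + 0
          off-diagonal e e< e≢e₀ = 𝟙-≉ (λ g^e≈w → e≢e₀ (^-injective e< e₀< (≈-trans g^e≈w (≈-sym g^e₀≈w))))

  ∑-g^ : ∀ (φ : ℕ → ℤ) → (∀ {x y} → x ≈ y → φ x ≡ φ y) → ∑[ e < p ∸ 1 ] φ (g ^ e) ≡ ∑[ i < p ∸ 1 ] φ (suc i)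
  ∑-g^ φ φ-cong = begin
    ∑[ e < p ∸ 1 ] φ (g ^ e)
      ≡⟨ ∑-cong (p ∸ 1) (λ e → sym (trans (∑-𝟙-sift (g ^ e) φ) (φ-cong (%-≈ (g ^ e))))) ⟩
    ∑[ e < p ∸ 1 ] ∑[ w < p ] 𝟙[ g ^ e ≈ w ] * φ w
      ≡⟨ ∑-comm (p ∸ 1) p _ ⟩
    ∑[ w < p ] ∑[ e < p ∸ 1 ] 𝟙[ g ^ e ≈ w ] * φ w
      ≡⟨ ∑-cong p (λ w → ∑-*ʳ (p ∸ 1) (φ w) _) ⟩
    ∑[ w < p ] logCount w * φ w
      ≡⟨ ∑-0+units _ ⟩
    logCount 0 * φ 0 + ∑[ i < p ∸ 1 ] logCount (suc i) * φ (suc i)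
      ≡⟨ cong₂ _+_ (cong (_* φ 0) logCount-0)
                   (∑-cong-< (p ∸ 1) (λ i i< → trans (cong (_* φ (suc i)) (logCount-unit (≉0-<p (s≤s z≤n) (suc-<p∸1 i<))))
                                                     (*-identityˡ (φ (suc i))))) ⟩
    + 0 * φ 0 + ∑[ i < p ∸ 1 ] φ (suc i)
      ≡⟨ +-identityˡ _ ⟩
    ∑[ i < p ∸ 1 ] φ (suc i) ∎
    where open ≡-Reasoning

  module Odd (p≢2 : p ≢ 2) where

    2∤p : ¬ 2 ∣ p
    2∤p 2∣p with prime⇒irreducible p-prime 2∣p
    ... | inj₁ ()
    ... | inj₂ 2≡p = p≢2 (sym 2≡p)

    p%2≡1 : p % 2 ≡ 1
    p%2≡1 with p % 2 in p%2≡r | m%n<n p 2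
    ... | 0           | _            = contradiction (m%n≡0⇒n∣m p 2 p%2≡r) 2∤p
    ... | 1           | _            = refl
    ... | suc (suc _) | s≤s (s≤s ())

    half : ℕ
    half = p / 2

    p∸1≡2*half : p ∸ 1 ≡ 2 ℕ.* half
    p∸1≡2*half = trans (cong (_∸ 1) (trans (m≡m%n+[m/n]*n p 2) (cong (ℕ._+ half ℕ.* 2) p%2≡1))) (ℕ.*-comm half 2)

    p∸1≡half+half : p ∸ 1 ≡ half ℕ.+ half
    p∸1≡half+half = trans p∸1≡2*half (cong (half ℕ.+_) (ℕ.+-identityʳ half))

    0<half : 0 < half
    0<half = ℕ.n≢0⇒n>0 λ half≡0 → ℕ.<⇒≢ (ℕ.m<n⇒0<n∸m 1<p) (sym (trans p∸1≡2*half (cong (2 ℕ.*_) half≡0)))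

    half<p∸1 : half < p ∸ 1
    half<p∸1 = subst (half <_) (sym p∸1≡half+half) (ℕ.m<m+n half 0<half)

    2d∣p∸1⇔d∣half : ∀ d → ((2 ℕ.* d) ∣ (p ∸ 1) → d ∣ half) × (d ∣ half → (2 ℕ.* d) ∣ (p ∸ 1))
    2d∣p∸1⇔d∣half d = (λ 2d∣p∸1 → *-cancelˡ-∣ 2 (subst ((2 ℕ.* d) ∣_) p∸1≡2*half 2d∣p∸1))
                    , (λ d∣half → subst ((2 ℕ.* d) ∣_) (sym p∸1≡2*half) (*-monoʳ-∣ 2 d∣half))

    g^half+1≈0 : g ^ half ℕ.+ 1 ≈ 0
    g^half+1≈0 = ⊎.[ (λ g^half≈1 → contradiction g^half≈1 (g^-order 0<half half<p∸1)) , (λ e → e) ]′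
                     (square≈1 (g ^ half) g^half²≈1)
      where
      g^half²≈1 : g ^ half ℕ.* g ^ half ≈ 1
      g^half²≈1 = ≈-trans (≡⇒≈ (trans (sym (ℕ.^-distribˡ-+-* g half half)) (cong (g ^_) (sym p∸1≡half+half)))) fermat

    𝟙-+1≈0 : ∀ x → 𝟙[ x ℕ.+ 1 ≈ 0 ] ≡ 𝟙[ x ≈ g ^ half ]
    𝟙-+1≈0 x = 𝟙-≈-⇔ (λ x+1≈0 → +-≈0-unique x+1≈0 g^half+1≈0)
                     (λ x≈g^half → ≈-trans (+-cong x≈g^half (≈-refl {1})) g^half+1≈0)

-- Coefficient vectors in ℤ[x]/(x^p − 1)

if-T-𝟙 : ∀ {P : Set} (b : Bool) (P? : Dec P) → (T b → P) → (P → T b) → (if b then + 1 else + 0) ≡ 𝟙 P?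
if-T-𝟙 true  P? b⇒P _   = sym (𝟙-yes P? (b⇒P _))
if-T-𝟙 false P? _   P⇒b = sym (𝟙-no P? P⇒b)

if-then-0 : ∀ (b : Bool) (z : ℤ) → (if b then z else + 0) ≡ (if b then + 1 else + 0) * z
if-then-0 true  z = sym (*-identityˡ z)
if-then-0 false z = refl

module GroupRing (p : ℕ) .{{_ : NonZero p}} where
  open Modulo p

  toℕ-% : ∀ (r : Fin p) → toℕ r % p ≡ toℕ r
  toℕ-% r = m<n⇒m%n≡m (toℕ<n r)

  ep≡𝟙 : ∀ x r → ep p x r ≡ 𝟙[ x ≈ toℕ r ]
  ep≡𝟙 x r = if-T-𝟙 (toℕ r ℕ.≡ᵇ x % p) _
    (λ t → sym (trans (toℕ-% r) (ℕ.≡ᵇ⇒≡ (toℕ r) (x % p) t)))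
    (λ x≈r → ℕ.≡⇒≡ᵇ (toℕ r) (x % p) (sym (trans x≈r (toℕ-% r))))

  count : List ℕ → ℕ → ℤ
  count xs ρ = ∑ˡ xs (λ x → 𝟙[ x ≈ ρ ])

  Counts : Cyc p → List ℕ → Set
  Counts f xs = ∀ r → f r ≡ count xs (toℕ r)

  sumC-apply : ∀ (fs : List (Cyc p)) r → sumC p fs r ≡ ∑ˡ fs (λ f → f r)
  sumC-apply []       r = refl
  sumC-apply (f ∷ fs) r = cong (_+_ (f r)) (sumC-apply fs r)

  sumC-ep-counts : ∀ {A : Set} (x : A → ℕ) ys → Counts (sumC p (map (λ y → ep p (x y)) ys)) (map x ys)
  sumC-ep-counts x ys r = begin
    sumC p (map (λ y → ep p (x y)) ys) r        ≡⟨ sumC-apply (map (λ y → ep p (x y)) ys) r ⟩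
    ∑ˡ (map (λ y → ep p (x y)) ys) (λ f → f r)  ≡⟨ ∑ˡ-map ys _ _ ⟩
    ∑ˡ ys (λ y → ep p (x y) r)                  ≡⟨ ∑ˡ-cong ys (λ y → ep≡𝟙 (x y) r) ⟩
    ∑ˡ ys (λ y → 𝟙[ x y ≈ toℕ r ])              ≡⟨ ∑ˡ-map ys x _ ⟨
    count (map x ys) (toℕ r)                    ∎
    where open ≡-Reasoning

  infixl 6 _⊕_
  _⊕_ : List ℕ → List ℕ → List ℕ
  xs ⊕ ys = concatMap (λ x → map (x ℕ.+_) ys) xs

  ∑ˡ-⊕ : ∀ xs ys (f : ℕ → ℤ) → ∑ˡ (xs ⊕ ys) f ≡ ∑ˡ xs (λ x → ∑ˡ ys (λ y → f (x ℕ.+ y)))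
  ∑ˡ-⊕ xs ys f = trans (∑ˡ-concatMap xs _ f) (∑ˡ-cong xs (λ x → ∑ˡ-map ys (x ℕ.+_) f))

  mulC-convolution : ∀ (f h : Cyc p) (F H : ℕ → ℤ) → (∀ i → f i ≡ F (toℕ i)) → (∀ j → h j ≡ H (toℕ j)) →
                     ∀ r → mulC p f h r ≡ ∑[ i < p ] ∑[ j < p ] 𝟙[ i ℕ.+ j ≈ toℕ r ] * (F i * H j)
  mulC-convolution f h F H f≡F h≡H r =
    ∑ˡ-allFin p _ _ λ i → ∑ˡ-allFin p _ _ λ j →
      let i+j = toℕ i ℕ.+ toℕ j in
      trans (if-then-0 (i+j % p ℕ.≡ᵇ toℕ r) (f i * h j))
            (cong₂ _*_ (if-T-𝟙 (i+j % p ℕ.≡ᵇ toℕ r) (i+j % p ℕ.≟ toℕ r % p)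
                               (λ t → trans (ℕ.≡ᵇ⇒≡ _ _ t) (sym (toℕ-% r)))
                               (λ e → ℕ.≡⇒≡ᵇ _ _ (trans e (toℕ-% r))))
                       (cong₂ _*_ (f≡F i) (h≡H j)))

  ∑-convolution-𝟙 : ∀ x y ρ →
                    ∑[ i < p ] ∑[ j < p ] 𝟙[ i ℕ.+ j ≈ ρ ] * (𝟙[ x ≈ i ] * 𝟙[ y ≈ j ]) ≡ 𝟙[ x ℕ.+ y ≈ ρ ]
  ∑-convolution-𝟙 x y ρ = begin
    ∑[ i < p ] ∑[ j < p ] 𝟙[ i ℕ.+ j ≈ ρ ] * (𝟙[ x ≈ i ] * 𝟙[ y ≈ j ])
      ≡⟨ ∑-cong p (λ i → trans (∑-cong p (λ j → reorder 𝟙[ i ℕ.+ j ≈ ρ ] 𝟙[ x ≈ i ] 𝟙[ y ≈ j ]))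
                                (∑-*ˡ p 𝟙[ x ≈ i ] _)) ⟩
    ∑[ i < p ] 𝟙[ x ≈ i ] * (∑[ j < p ] 𝟙[ y ≈ j ] * 𝟙[ i ℕ.+ j ≈ ρ ])
      ≡⟨ ∑-cong p (λ i → cong (𝟙[ x ≈ i ] *_) (∑-𝟙-sift y (λ j → 𝟙[ i ℕ.+ j ≈ ρ ]))) ⟩
    ∑[ i < p ] 𝟙[ x ≈ i ] * 𝟙[ i ℕ.+ y % p ≈ ρ ]
      ≡⟨ ∑-𝟙-sift x (λ i → 𝟙[ i ℕ.+ y % p ≈ ρ ]) ⟩
    𝟙[ x % p ℕ.+ y % p ≈ ρ ]
      ≡⟨ 𝟙-congˡ (+-cong (%-≈ x) (%-≈ y)) ⟩
    𝟙[ x ℕ.+ y ≈ ρ ] ∎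
    where open ≡-Reasoning
          reorder : ∀ a b c → a * (b * c) ≡ b * (c * a)
          reorder = solve-∀

  mulC-counts : ∀ {f h xs ys} → Counts f xs → Counts h ys → Counts (mulC p f h) (xs ⊕ ys)
  mulC-counts {f} {h} {xs} {ys} f-counts h-counts r = begin
    mulC p f h r
      ≡⟨ mulC-convolution f h (count xs) (count ys) f-counts h-counts r ⟩
    ∑[ i < p ] ∑[ j < p ] 𝟙[ i ℕ.+ j ≈ ρ ] * (count xs i * count ys j)
      ≡⟨ ∑-cong p (λ i → ∑-cong p (λ j → expand 𝟙[ i ℕ.+ j ≈ ρ ] (λ x → 𝟙[ x ≈ i ]) (λ y → 𝟙[ y ≈ j ]))) ⟩
    ∑[ i < p ] ∑[ j < p ] ∑ˡ xs (λ x → ∑ˡ ys (λ y → term x y i j))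
      ≡⟨ ∑-cong p (λ i → trans (sym (∑ˡ-∑-comm xs p (λ x j → ∑ˡ ys (λ y → term x y i j))))
                                (∑ˡ-cong xs (λ x → sym (∑ˡ-∑-comm ys p (λ y j → term x y i j))))) ⟩
    ∑[ i < p ] ∑ˡ xs (λ x → ∑ˡ ys (λ y → ∑[ j < p ] term x y i j))
      ≡⟨ trans (sym (∑ˡ-∑-comm xs p (λ x i → ∑ˡ ys (λ y → ∑[ j < p ] term x y i j))))
               (∑ˡ-cong xs (λ x → sym (∑ˡ-∑-comm ys p (λ y i → ∑[ j < p ] term x y i j)))) ⟩
    ∑ˡ xs (λ x → ∑ˡ ys (λ y → ∑[ i < p ] ∑[ j < p ] term x y i j))
      ≡⟨ ∑ˡ-cong xs (λ x → ∑ˡ-cong ys (λ y → ∑-convolution-𝟙 x y ρ)) ⟩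
    ∑ˡ xs (λ x → ∑ˡ ys (λ y → 𝟙[ x ℕ.+ y ≈ ρ ]))
      ≡⟨ ∑ˡ-⊕ xs ys (λ z → 𝟙[ z ≈ ρ ]) ⟨
    count (xs ⊕ ys) ρ ∎
    where
    open ≡-Reasoning
    ρ = toℕ r
    term : ℕ → ℕ → ℕ → ℕ → ℤ
    term x y i j = 𝟙[ i ℕ.+ j ≈ ρ ] * (𝟙[ x ≈ i ] * 𝟙[ y ≈ j ])
    expand : ∀ c (a b : ℕ → ℤ) → c * (∑ˡ xs a * ∑ˡ ys b) ≡ ∑ˡ xs (λ x → ∑ˡ ys (λ y → c * (a x * b y)))
    expand c a b = begin
      c * (∑ˡ xs a * ∑ˡ ys b)                      ≡⟨ cong (c *_) (∑ˡ-*ʳ xs (∑ˡ ys b) a) ⟨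
      c * ∑ˡ xs (λ x → a x * ∑ˡ ys b)              ≡⟨ ∑ˡ-*ˡ xs c _ ⟨
      ∑ˡ xs (λ x → c * (a x * ∑ˡ ys b))            ≡⟨ ∑ˡ-cong xs (λ x → cong (c *_) (∑ˡ-*ˡ ys (a x) b)) ⟨
      ∑ˡ xs (λ x → c * ∑ˡ ys (λ y → a x * b y))    ≡⟨ ∑ˡ-cong xs (λ x → ∑ˡ-*ˡ ys c _) ⟨
      ∑ˡ xs (λ x → ∑ˡ ys (λ y → c * (a x * b y)))  ∎

  conjC-counts : ∀ {f xs} → Counts f xs → Counts (conjC p f) (map negate xs)
  conjC-counts {f} {xs} f-counts r = begin
    f ((p ∸ ρ) mod p)                       ≡⟨ f-counts _ ⟩
    count xs (toℕ ((p ∸ ρ) mod p))          ≡⟨ cong (count xs) (toℕ-fromℕ< (m%n<n (p ∸ ρ) p)) ⟩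
    count xs ((p ∸ ρ) % p)                  ≡⟨ ∑ˡ-cong xs (λ x → 𝟙-≈-⇔ (⇒negate x) (negate⇒ x)) ⟩
    ∑ˡ xs (λ x → 𝟙[ negate x ≈ ρ ])         ≡⟨ ∑ˡ-map xs negate _ ⟨
    count (map negate xs) ρ                 ∎
    where
    open ≡-Reasoning
    ρ = toℕ r
    p∸ρ+ρ≈0 : (p ∸ ρ) ℕ.+ ρ ≈ 0
    p∸ρ+ρ≈0 = ≈-trans (≡⇒≈ (ℕ.m∸n+n≡m (ℕ.<⇒≤ (toℕ<n r)))) p≈0
    x+negate-x≈0 : ∀ x → x ℕ.+ negate x ≈ 0
    x+negate-x≈0 x = ≈-trans (≡⇒≈ (ℕ.+-comm x (negate x))) (negate-inverse x)
    ⇒negate : ∀ x → x ≈ (p ∸ ρ) % p → negate x ≈ ρ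
    ⇒negate x x≈p∸ρ = ≈-sym (+-≈0-unique {c = x} (≈-trans (≡⇒≈ (ℕ.+-comm ρ x))
                        (≈-trans (+-cong (≈-trans x≈p∸ρ (%-≈ (p ∸ ρ))) (≈-refl {ρ})) p∸ρ+ρ≈0)) (negate-inverse x))
    negate⇒ : ∀ x → negate x ≈ ρ → x ≈ (p ∸ ρ) % p
    negate⇒ x negate-x≈ρ = ≈-trans (+-≈0-unique (≈-trans (+-cong (≈-refl {x}) (≈-sym negate-x≈ρ)) (x+negate-x≈0 x)) p∸ρ+ρ≈0)
                                   (≈-sym (%-≈ (p ∸ ρ)))

-- The fourth moment of the Gauss periods

linear-elimination : ∀ n .{{_ : NonZero n}} (a b x c : ℤ) → a ≡ + n * x → a + + n * b ≡ + n * c →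
                     a ≡ ((+ n + + 1) * x - c) + b
linear-elimination n a b x c a≡nx total = *-cancelˡ-≡ (+ n) a _ (sym (begin
  + n * (((+ n + + 1) * x - c) + b)                ≡⟨ expand (+ n) x b c ⟩
  + n * (+ n * x) + (+ n * x + + n * b - + n * c)
    ≡⟨ cong (λ t → + n * (+ n * x) + (t + + n * b - + n * c)) a≡nx ⟨
  + n * (+ n * x) + (a + + n * b - + n * c)        ≡⟨ cong (λ t → + n * (+ n * x) + (t - + n * c)) total ⟩
  + n * (+ n * x) + (+ n * c - + n * c)            ≡⟨ cancel (+ n * (+ n * x)) (+ n * c) ⟩
  + n * (+ n * x)                                  ≡⟨ cong (+ n *_) a≡nx ⟨
  + n * a                                          ∎))
  where
  open ≡-Reasoning
  expand : ∀ n x b c → n * (((n + + 1) * x - c) + b) ≡ n * (n * x) + (n * x + n * b - n * c)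
  expand = solve-∀
  cancel : ∀ u v → u + (v - v) ≡ u
  cancel = solve-∀

module GaussPeriods (p g d : ℕ) .{{_ : NonZero p}} .{{_ : NonZero d}} (p-prime : Prime p) (p≢2 : p ≢ 2)
                    (primRoot : IsPrimitiveRoot p g) (d∣p∸1 : d ∣ p ∸ 1) where
  open Modulo p
  open Field p-prime
  open PrimitiveRoot p g p-prime primRoot
  open Odd p≢2
  open GroupRing p

  K : ℕ
  K = k p g d

  d*K≡p∸1 : d ℕ.* K ≡ p ∸ 1
  d*K≡p∸1 = m*[n/m]≡n d∣p∸1

  coset : ℕ → ℕ → ℕ
  coset s j = g ^ (d ℕ.* j ℕ.+ s)

  γ : ℕ → ℕ
  γ j = g ^ (d ℕ.* j)

  alt : ℕ → ℕ → ℕ → ℕ → ℕ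
  alt x₁ x₂ x₃ x₄ = (x₁ ℕ.+ negate x₂) ℕ.+ (x₃ ℕ.+ negate x₄)

  alt-cong : ∀ {x₁ x₂ x₃ x₄ y₁ y₂ y₃ y₄} → x₁ ≈ y₁ → x₂ ≈ y₂ → x₃ ≈ y₃ → x₄ ≈ y₄ →
             alt x₁ x₂ x₃ x₄ ≈ alt y₁ y₂ y₃ y₄
  alt-cong e₁ e₂ e₃ e₄ = +-cong (+-cong e₁ (≡⇒≈ (negate-cong e₂))) (+-cong e₃ (≡⇒≈ (negate-cong e₄)))

  alt-* : ∀ c x₁ x₂ x₃ x₄ → alt (c ℕ.* x₁) (c ℕ.* x₂) (c ℕ.* x₃) (c ℕ.* x₄) ≈ c ℕ.* alt x₁ x₂ x₃ x₄
  alt-* c x₁ x₂ x₃ x₄ =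
    ≈-trans (+-cong (+-cong (≈-refl {c ℕ.* x₁}) (negate-* c x₂)) (+-cong (≈-refl {c ℕ.* x₃}) (negate-* c x₄)))
            (≡⇒≈ (factor c x₁ (negate x₂) x₃ (negate x₄)))
    where
    factor : ∀ c a b e f → (c ℕ.* a ℕ.+ c ℕ.* b) ℕ.+ (c ℕ.* e ℕ.+ c ℕ.* f) ≡ c ℕ.* ((a ℕ.+ b) ℕ.+ (e ℕ.+ f))
    factor = ℕ-solve-∀

  N₄ : ℕ → ℕ → ℤ
  N₄ s ρ = ∑⁴ K (λ j₁ j₂ j₃ j₄ → 𝟙[ alt (coset s j₁) (coset s j₂) (coset s j₃) (coset s j₄) ≈ ρ ])

  N : ℕ → ℤ
  N ρ = ∑[ s < d ] N₄ s ρ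

  cosetList : ℕ → List ℕ
  cosetList s = map (coset s) (upTo K)

  differences : ℕ → List ℕ
  differences s = cosetList s ⊕ map negate (cosetList s)

  ∑ˡ-differences : ∀ s (F : ℕ → ℤ) →
                   ∑ˡ (differences s) F ≡ ∑[ j₁ < K ] ∑[ j₂ < K ] F (coset s j₁ ℕ.+ negate (coset s j₂))
  ∑ˡ-differences s F =
    trans (∑ˡ-⊕ (cosetList s) _ F)
          (trans (∑ˡ-map-upTo K (coset s) _)
                 (∑-cong K λ j₁ → trans (∑ˡ-map (cosetList s) negate _) (∑ˡ-map-upTo K (coset s) _)))

  |η|⁴-counts : ∀ s → Counts (abs4 p (η p g d s)) (differences s ⊕ differences s)
  |η|⁴-counts s = mulC-counts {xs = differences s} {ys = differences s} |η|²-counts |η|²-counts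
    where
    η-counts : Counts (η p g d s) (cosetList s)
    η-counts = sumC-ep-counts (coset s) (upTo K)
    |η|²-counts : Counts (mulC p (η p g d s) (conjC p (η p g d s))) (differences s)
    |η|²-counts = mulC-counts {xs = cosetList s} {ys = map negate (cosetList s)}
                              η-counts (conjC-counts {xs = cosetList s} η-counts)

  V4-coefficient : ∀ r → V4 p g d r ≡ N (toℕ r)
  V4-coefficient r = begin
    V4 p g d r
      ≡⟨ sumC-apply (map (λ s → abs4 p (η p g d s)) (upTo d)) r ⟩
    ∑ˡ (map (λ s → abs4 p (η p g d s)) (upTo d)) (λ f → f r) ≡⟨ ∑ˡ-map-upTo d _ (λ f → f r) ⟩
    ∑[ s < d ] abs4 p (η p g d s) r                          ≡⟨ ∑-cong d (λ s → |η|⁴-counts s r) ⟩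
    ∑[ s < d ] count (differences s ⊕ differences s) ρ       ≡⟨ ∑-cong d unfold ⟩
    N ρ                                                      ∎
    where
    open ≡-Reasoning
    ρ = toℕ r
    unfold : ∀ s → count (differences s ⊕ differences s) ρ ≡ N₄ s ρ
    unfold s = trans (∑ˡ-⊕ (differences s) _ _)
                     (trans (∑ˡ-differences s _) (∑-cong K λ j₁ → ∑-cong K λ j₂ → ∑ˡ-differences s _))

  coset-suc : ∀ s j → coset (suc s) j ≡ g ℕ.* coset s j
  coset-suc s j = cong (g ^_) (ℕ.+-suc (d ℕ.* j) s)

  coset-d : ∀ j → coset d j ≡ coset 0 (suc j)
  coset-d j = cong (g ^_) (trans (ℕ.+-comm (d ℕ.* j) d) (trans (sym (ℕ.*-suc d j)) (sym (ℕ.+-identityʳ _))))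

  coset-K : coset 0 K ≈ coset 0 0
  coset-K = ≈-trans (≡⇒≈ (cong (g ^_) (trans (ℕ.+-identityʳ (d ℕ.* K)) d*K≡p∸1)))
                    (≈-trans fermat (≡⇒≈ (cong (g ^_) (sym (trans (ℕ.+-identityʳ (d ℕ.* 0)) (ℕ.*-zeroʳ d))))))

  N₄-suc : ∀ s ρ → N₄ (suc s) (g ℕ.* ρ) ≡ N₄ s ρ
  N₄-suc s ρ = ∑⁴-cong K λ j₁ j₂ j₃ j₄ →
    trans (𝟙-congˡ (≈-trans (alt-cong (shift j₁) (shift j₂) (shift j₃) (shift j₄)) (alt-* g _ _ _ _)))
          (𝟙-*-cancelˡ g g≉0)
    where shift : ∀ j → coset (suc s) j ≈ g ℕ.* coset s j
          shift j = ≡⇒≈ (coset-suc s j)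

  N₄-period : ∀ ρ → N₄ d ρ ≡ N₄ 0 ρ
  N₄-period ρ =
    trans (∑⁴-cong K λ j₁ j₂ j₃ j₄ →
             𝟙-congˡ (alt-cong (≡⇒≈ (coset-d j₁)) (≡⇒≈ (coset-d j₂)) (≡⇒≈ (coset-d j₃)) (≡⇒≈ (coset-d j₄))))
          (∑⁴-rotate K term (λ b c e → 𝟙-congˡ (alt-cong coset-K (r b) (r c) (r e)))
                            (λ a c e → 𝟙-congˡ (alt-cong (r a) coset-K (r c) (r e)))
                            (λ a b e → 𝟙-congˡ (alt-cong (r a) (r b) coset-K (r e)))
                            (λ a b c → 𝟙-congˡ (alt-cong (r a) (r b) (r c) coset-K)))
    where
    term : ℕ → ℕ → ℕ → ℕ → ℤ
    term j₁ j₂ j₃ j₄ = 𝟙[ alt (coset 0 j₁) (coset 0 j₂) (coset 0 j₃) (coset 0 j₄) ≈ ρ ]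
    r : ∀ j → coset 0 j ≈ coset 0 j
    r j = ≈-refl

  N-*g : ∀ ρ → N (g ℕ.* ρ) ≡ N ρ
  N-*g ρ = trans (sym (∑-rotate d (λ s → N₄ s (g ℕ.* ρ)) (N₄-period (g ℕ.* ρ)))) (∑-cong d (λ s → N₄-suc s ρ))

  N-cong : ∀ {ρ ρ′} → ρ ≈ ρ′ → N ρ ≡ N ρ′
  N-cong ρ≈ρ′ = ∑-cong d λ s → ∑⁴-cong K λ _ _ _ _ → 𝟙-congʳ ρ≈ρ′

  N-g^ : ∀ e → N (g ^ e) ≡ N 1
  N-g^ zero    = refl
  N-g^ (suc e) = trans (N-*g (g ^ e)) (N-g^ e)

  N-unit : ∀ {ρ} → ¬ ρ ≈ 0 → N ρ ≡ N 1
  N-unit ρ≉0 with discreteLog _ ρ≉0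
  ... | e , _ , g^e≈ρ = trans (N-cong (≈-sym g^e≈ρ)) (N-g^ e)

  ∑-N : ∑[ ρ < p ] N ρ ≡ + d * (+ K * (+ K * (+ K * (+ K * + 1))))
  ∑-N = trans (∑-comm p d (λ ρ s → N₄ s ρ)) (trans (∑-cong d (λ _ → ∑-N₄)) (∑-const d _))
    where ∑-N₄ : ∀ {s} → ∑[ ρ < p ] N₄ s ρ ≡ + K * (+ K * (+ K * (+ K * + 1)))
          ∑-N₄ = trans (sym (∑⁴-∑-comm K p _)) (trans (∑⁴-cong K (λ _ _ _ _ → ∑-𝟙 _)) (∑⁴-const K (+ 1)))

  ∑-N-split : ∑[ ρ < p ] N ρ ≡ N 0 + + (p ∸ 1) * N 1
  ∑-N-split = trans (∑-0+units N) (cong (_+_ (N 0))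
    (trans (∑-cong-< (p ∸ 1) (λ i i< → N-unit (≉0-<p (s≤s z≤n) (suc-<p∸1 i<)))) (∑-const (p ∸ 1) (N 1))))

  energy : ℤ
  energy = ∑⁴ K (λ j₁ j₂ j₃ j₄ → 𝟙[ γ j₁ ℕ.+ γ j₃ ≈ γ j₂ ℕ.+ γ j₄ ])

  alt-≈0 : ∀ x₁ x₂ x₃ x₄ → 𝟙[ alt x₁ x₂ x₃ x₄ ≈ 0 ] ≡ 𝟙[ x₁ ℕ.+ x₃ ≈ x₂ ℕ.+ x₄ ]
  alt-≈0 x₁ x₂ x₃ x₄ = 𝟙-≈-⇔ (λ alt≈0 → ≈-trans (≈-sym alt+x₂+x₄≈x₁+x₃) (+-cong alt≈0 (≈-refl {x₂ ℕ.+ x₄})))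
                             (λ x₁+x₃≈x₂+x₄ → +-cancelʳ (x₂ ℕ.+ x₄) (≈-trans alt+x₂+x₄≈x₁+x₃ x₁+x₃≈x₂+x₄))
    where
    rearrange : ∀ x₁ y₂ x₃ y₄ x₂ x₄ →
                (x₁ ℕ.+ y₂ ℕ.+ (x₃ ℕ.+ y₄)) ℕ.+ (x₂ ℕ.+ x₄) ≡ (x₁ ℕ.+ x₃) ℕ.+ ((y₂ ℕ.+ x₂) ℕ.+ (y₄ ℕ.+ x₄))
    rearrange = ℕ-solve-∀
    alt+x₂+x₄≈x₁+x₃ : alt x₁ x₂ x₃ x₄ ℕ.+ (x₂ ℕ.+ x₄) ≈ x₁ ℕ.+ x₃
    alt+x₂+x₄≈x₁+x₃ = ≈-trans (≡⇒≈ (rearrange x₁ (negate x₂) x₃ (negate x₄) x₂ x₄))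
                              (+-≈0ʳ (+-cong (negate-inverse x₂) (negate-inverse x₄)))

  N₄-0 : ∀ s → N₄ s 0 ≡ energy
  N₄-0 zero    = ∑⁴-cong K λ j₁ j₂ j₃ j₄ →
    trans (𝟙-congˡ (alt-cong (γ-coset j₁) (γ-coset j₂) (γ-coset j₃) (γ-coset j₄)))
          (alt-≈0 (γ j₁) (γ j₂) (γ j₃) (γ j₄))
    where γ-coset : ∀ j → coset 0 j ≈ γ j
          γ-coset j = ≡⇒≈ (cong (g ^_) (ℕ.+-identityʳ (d ℕ.* j)))
  N₄-0 (suc s) = trans (cong (N₄ (suc s)) (sym (ℕ.*-zeroʳ g))) (trans (N₄-suc s 0) (N₄-0 s))

  N-0 : N 0 ≡ + d * energy
  N-0 = trans (∑-cong d N₄-0) (∑-const d energy)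

  N-0-formula : ∀ X → energy ≡ + K * X → N 0 ≡ (+ p * X - (+ K) ℤ.^ 3) + N 1
  N-0-formula X energy≡KX =
    subst (λ n → N 0 ≡ (n * X - (+ K) ℤ.^ 3) + N 1) p∸1+1≡p
          (linear-elimination (p ∸ 1) {{>-nonZero (ℕ.m<n⇒0<n∸m 1<p)}} (N 0) (N 1) X ((+ K) ℤ.^ 3) N-0≡ total)
    where
    open ≡-Reasoning
    +d*K≡p∸1 : + d * + K ≡ + (p ∸ 1)
    +d*K≡p∸1 = trans (sym (pos-* d K)) (cong +_ d*K≡p∸1)
    p∸1+1≡p : + (p ∸ 1) + + 1 ≡ + p
    p∸1+1≡p = trans (sym (pos-+ (p ∸ 1) 1)) (cong +_ (ℕ.m∸n+n≡m (ℕ.<⇒≤ 1<p)))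
    N-0≡ : N 0 ≡ + (p ∸ 1) * X
    N-0≡ = begin
      N 0                 ≡⟨ N-0 ⟩
      + d * energy        ≡⟨ cong (+ d *_) energy≡KX ⟩
      + d * (+ K * X)     ≡⟨ *-assoc (+ d) (+ K) X ⟨
      + d * + K * X       ≡⟨ cong (_* X) +d*K≡p∸1 ⟩
      + (p ∸ 1) * X       ∎
    total : N 0 + + (p ∸ 1) * N 1 ≡ + (p ∸ 1) * (+ K) ℤ.^ 3
    total = begin
      N 0 + + (p ∸ 1) * N 1                        ≡⟨ ∑-N-split ⟨
      ∑[ ρ < p ] N ρ                               ≡⟨ ∑-N ⟩
      + d * (+ K * (+ K * (+ K * (+ K * + 1))))    ≡⟨ regroup (+ d) (+ K) ⟩
      + d * + K * (+ K) ℤ.^ 3                      ≡⟨ cong (_* (+ K) ℤ.^ 3) +d*K≡p∸1 ⟩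
      + (p ∸ 1) * (+ K) ℤ.^ 3                      ∎
      where regroup : ∀ d K → d * (K * (K * (K * (K * + 1)))) ≡ d * K * (K * (K * (K * + 1)))
            regroup = solve-∀

  V4-≈C : ∀ c → N 0 ≡ c + N 1 → _≈C_ p (V4 p g d) (constC p c)
  V4-≈C c N-0≡c+N-1 = N 1 , λ r →
    trans (V4-coefficient r) (trans (N-coefficient (toℕ r) (toℕ<n r)) (cong (λ t → c * t + N 1) (sym (ep≡𝟙 0 r))))
    where
    N-coefficient : ∀ ρ → ρ < p → N ρ ≡ c * 𝟙[ 0 ≈ ρ ] + N 1
    N-coefficient zero    _   = trans N-0≡c+N-1 (cong (_+ N 1) (sym (trans (cong (c *_) (𝟙-≈ ≈-refl)) (*-identityʳ c))))
    N-coefficient (suc i) i<p = trans (N-unit suc-i≉0)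
      (sym (trans (cong (λ t → c * t + N 1) (𝟙-≉ (suc-i≉0 ∘ ≈-sym)))
                  (trans (cong (_+ N 1) (*-zeroʳ c)) (+-identityˡ (N 1)))))
      where suc-i≉0 = ≉0-<p (s≤s z≤n) i<p

  V4-≈C-energy : ∀ X c → energy ≡ + K * X → + p * X - (+ K) ℤ.^ 3 ≡ c → _≈C_ p (V4 p g d) (constC p c)
  V4-≈C-energy X c energy≡KX c≡ = V4-≈C c (trans (N-0-formula X energy≡KX) (cong (_+ N 1) c≡))

  -- The subgroup Γ = ⟨g^d⟩

  coset≡γ* : ∀ l j → coset l j ≡ γ j ℕ.* g ^ l
  coset≡γ* l j = ℕ.^-distribˡ-+-* g (d ℕ.* j) l

  γ-+ : ∀ i j → γ (i ℕ.+ j) ≡ γ i ℕ.* γ j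
  γ-+ i j = trans (cong (g ^_) (ℕ.*-distribˡ-+ d i j)) (ℕ.^-distribˡ-+-* g (d ℕ.* i) (d ℕ.* j))

  γ-periodic : ∀ j → γ (j ℕ.+ K) ≈ γ j
  γ-periodic j = ≈-trans (≡⇒≈ (cong (g ^_) (trans (ℕ.*-distribˡ-+ d j K) (cong (d ℕ.* j ℕ.+_) d*K≡p∸1))))
                         (g^-periodic (d ℕ.* j))

  d*j<p∸1 : ∀ {j} → j < K → d ℕ.* j < p ∸ 1
  d*j<p∸1 {j} j<K = subst (d ℕ.* j <_) d*K≡p∸1 (ℕ.*-monoʳ-< d j<K)

  ∑-units-by-cosets : ∀ (φ : ℕ → ℤ) → (∀ {x y} → x ≈ y → φ x ≡ φ y) →
                      ∑[ i < p ∸ 1 ] φ (suc i) ≡ ∑[ l < d ] ∑[ j < K ] φ (coset l j)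
  ∑-units-by-cosets φ φ-cong = begin
    ∑[ i < p ∸ 1 ] φ (suc i)                          ≡⟨ ∑-g^ φ φ-cong ⟨
    ∑[ e < p ∸ 1 ] φ (g ^ e)                          ≡⟨ cong (λ n → ∑[ e < n ] φ (g ^ e)) d*K≡p∸1 ⟨
    ∑[ e < d ℕ.* K ] φ (g ^ e)                        ≡⟨ ∑-blocks d K _ ⟩
    ∑[ j < K ] ∑[ l < d ] φ (g ^ (j ℕ.* d ℕ.+ l))     ≡⟨ ∑-comm K d _ ⟩
    ∑[ l < d ] ∑[ j < K ] φ (g ^ (j ℕ.* d ℕ.+ l))
      ≡⟨ ∑-cong d (λ l → ∑-cong K (λ j → cong (λ t → φ (g ^ (t ℕ.+ l))) (ℕ.*-comm j d))) ⟩
    ∑[ l < d ] ∑[ j < K ] φ (coset l j)               ∎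
    where open ≡-Reasoning

  ∑Γ-* : ∀ (φ : ℕ → ℤ) → (∀ {x y} → x ≈ y → φ x ≡ φ y) → ∀ m → ∑[ j < K ] φ (γ j ℕ.* γ m) ≡ ∑[ j < K ] φ (γ j)
  ∑Γ-* φ φ-cong m = trans (∑-cong K (λ j → cong φ (sym (γ-+ j m))))
                          (∑-shift K (φ ∘ γ) (λ j → φ-cong (γ-periodic j)) m)

  ∑Γ-𝟙 : ∀ {e} → e < p ∸ 1 → ∑[ j < K ] 𝟙[ γ j ≈ g ^ e ] ≡ 𝟙 (d ∣? e)
  ∑Γ-𝟙 {e} e<p∸1 with d ∣? e
  ... | no  d∤e = ∑-zero K (λ j j<K → 𝟙-≉ (λ γj≈g^e →
                    d∤e (divides j (trans (sym (^-injective (d*j<p∸1 j<K) e<p∸1 γj≈g^e)) (ℕ.*-comm d j)))))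
  ... | yes (divides q e≡q*d) = trans (∑-single K _ q q<K off-diagonal) (𝟙-≈ (≡⇒≈ (cong (g ^_) d*q≡e)))
    where
    d*q≡e : d ℕ.* q ≡ e
    d*q≡e = trans (ℕ.*-comm d q) (sym e≡q*d)
    q<K : q < K
    q<K = ℕ.*-cancelˡ-< d q K (subst (_< d ℕ.* K) (sym d*q≡e) (subst (e <_) (sym d*K≡p∸1) e<p∸1))
    off-diagonal : ∀ j → j < K → j ≢ q → 𝟙[ γ j ≈ g ^ e ] ≡ + 0
    off-diagonal j j<K j≢q = 𝟙-≉ (λ γj≈g^e → j≢q (ℕ.*-cancelˡ-≡ j q d
      (trans (^-injective (d*j<p∸1 j<K) e<p∸1 γj≈g^e) (sym d*q≡e))))

  ∑Γ-𝟙-1 : ∑[ j < K ] 𝟙[ γ j ≈ 1 ] ≡ + 1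
  ∑Γ-𝟙-1 = trans (∑Γ-𝟙 (ℕ.m<n⇒0<n∸m 1<p)) (𝟙-yes (d ∣? 0) (d ∣0))

  c0≡∑² : ∀ m n → + c0 p g d m n ≡ ∑² K (λ i j → 𝟙[ γ i ℕ.+ g ^ m ℕ.* γ j ≈ g ^ n ])
  c0≡∑² m n = begin
    + c0 p g d m n
      ≡⟨ length-filter _ (cartesianProduct (Γ p g d) (Γ p g d)) ⟩
    ∑ˡ (cartesianProduct (Γ p g d) (Γ p g d)) (λ ab → 𝟙[ proj₁ ab ℕ.+ g ^ m ℕ.* proj₂ ab ≈ g ^ n ])
      ≡⟨ ∑ˡ-cartesianProduct (Γ p g d) (Γ p g d) _ ⟩
    ∑ˡ (Γ p g d) (λ a → ∑ˡ (Γ p g d) (λ b → 𝟙[ a ℕ.+ g ^ m ℕ.* b ≈ g ^ n ]))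
      ≡⟨ ∑ˡ-map-upTo K (λ i → γ i % p) _ ⟩
    ∑[ i < K ] ∑ˡ (Γ p g d) (λ b → 𝟙[ γ i % p ℕ.+ g ^ m ℕ.* b ≈ g ^ n ])
      ≡⟨ ∑-cong K (λ i → ∑ˡ-map-upTo K (λ j → γ j % p) _) ⟩
    ∑² K (λ i j → 𝟙[ γ i % p ℕ.+ g ^ m ℕ.* (γ j % p) ≈ g ^ n ])
      ≡⟨ ∑²-cong K (λ i j → 𝟙-congˡ (+-cong (%-≈ (γ i)) (*-cong (≈-refl {g ^ m}) (%-≈ (γ j))))) ⟩
    ∑² K (λ i j → 𝟙[ γ i ℕ.+ g ^ m ℕ.* γ j ≈ g ^ n ]) ∎
    where open ≡-Reasoning

  sumNℤ-squares : ∀ {f : ℕ → ℕ} {F : ℕ → ℤ} → (∀ l → + f l ≡ F l) →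
                  sumNℤ p g d (λ l → f l ℕ.^ 2) d ≡ ∑[ l < d ] F l * F l
  sumNℤ-squares {f} f≡F = trans (∑ˡ-upTo d _) (∑-cong d (λ l →
    trans (pos-* (f l) (f l ℕ.* 1)) (cong₂ _*_ (f≡F l) (trans (cong +_ (ℕ.*-identityʳ (f l))) (f≡F l)))))

  -- Formula (b): the energy through representation numbers

  R : ℕ → ℤ
  R w = ∑² K (λ i j → 𝟙[ γ i ℕ.+ γ j ≈ w ])

  R-cong : ∀ {w w′} → w ≈ w′ → R w ≡ R w′
  R-cong w≈w′ = ∑²-cong K (λ _ _ → 𝟙-congʳ w≈w′)

  energy≡∑R² : energy ≡ ∑[ w < p ] R w * R w
  energy≡∑R² =
    trans (∑⁴-cong K (λ j₁ j₂ j₃ j₄ → 𝟙-split (γ j₁ ℕ.+ γ j₃) (γ j₂ ℕ.+ γ j₄)))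
          (trans (∑⁴-∑-comm K p _)
                 (∑-cong p (λ w → ∑⁴-product K (λ i j → 𝟙[ γ i ℕ.+ γ j ≈ w ]) (λ i j → 𝟙[ γ i ℕ.+ γ j ≈ w ]))))

  R-*γ : ∀ m w → R (γ m ℕ.* w) ≡ R w
  R-*γ m w = begin
    ∑² K (λ i j → 𝟙[ γ i ℕ.+ γ j ≈ γ m ℕ.* w ])
      ≡⟨ ∑Γ-* (λ x → ∑[ j < K ] 𝟙[ x ℕ.+ γ j ≈ γ m ℕ.* w ]) (λ x≈y → ∑-cong K (λ _ → 𝟙-congˡ (+-cong x≈y ≈-refl))) m ⟨
    ∑² K (λ i j → 𝟙[ γ i ℕ.* γ m ℕ.+ γ j ≈ γ m ℕ.* w ])
      ≡⟨ ∑-cong K (λ i → ∑Γ-* (λ y → 𝟙[ γ i ℕ.* γ m ℕ.+ y ≈ γ m ℕ.* w ]) (λ x≈y → 𝟙-congˡ (+-cong ≈-refl x≈y)) m) ⟨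
    ∑² K (λ i j → 𝟙[ γ i ℕ.* γ m ℕ.+ γ j ℕ.* γ m ≈ γ m ℕ.* w ])
      ≡⟨ ∑²-cong K (λ i j → trans (cong (λ t → 𝟙[ t ≈ γ m ℕ.* w ]) (factor (γ i) (γ j) (γ m)))
                                  (𝟙-*-cancelˡ (γ m) (g^-≉0 (d ℕ.* m)))) ⟩
    ∑² K (λ i j → 𝟙[ γ i ℕ.+ γ j ≈ w ]) ∎
    where open ≡-Reasoning
          factor : ∀ a b c → a ℕ.* c ℕ.+ b ℕ.* c ≡ c ℕ.* (a ℕ.+ b)
          factor = ℕ-solve-∀

  R-coset : ∀ l j → R (coset l j) ≡ R (g ^ l)
  R-coset l j = trans (cong R (coset≡γ* l j)) (R-*γ j (g ^ l))

  ∑R²-split : ∑[ w < p ] R w * R w ≡ R 0 * R 0 + + K * (∑[ l < d ] R (g ^ l) * R (g ^ l))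
  ∑R²-split = begin
    ∑[ w < p ] R w * R w                                        ≡⟨ ∑-0+units _ ⟩
    R 0 * R 0 + ∑[ i < p ∸ 1 ] R (suc i) * R (suc i)
      ≡⟨ cong (_+_ (R 0 * R 0)) (∑-units-by-cosets _ (λ e → cong₂ _*_ (R-cong e) (R-cong e))) ⟩
    R 0 * R 0 + ∑[ l < d ] ∑[ j < K ] R (coset l j) * R (coset l j)
      ≡⟨ cong (_+_ (R 0 * R 0))
              (∑-cong d (λ l → trans (∑-cong K (λ j → cong₂ _*_ (R-coset l j) (R-coset l j))) (∑-const K _))) ⟩
    R 0 * R 0 + ∑[ l < d ] + K * (R (g ^ l) * R (g ^ l))         ≡⟨ cong (_+_ (R 0 * R 0)) (∑-*ˡ d (+ K) _) ⟩
    R 0 * R 0 + + K * (∑[ l < d ] R (g ^ l) * R (g ^ l))         ∎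
    where open ≡-Reasoning

  -- γ_i + γ_j ≡ 0 iff γ_j γ_i⁻¹ ≡ −1 ≡ g^half, which lies in Γ iff d ∣ half
  R-0 : R 0 ≡ + K * δα p g d
  R-0 = begin
    ∑² K (λ i j → 𝟙[ γ i ℕ.+ γ j ≈ 0 ])
      ≡⟨ ∑-cong K (λ i → ∑Γ-* (λ y → 𝟙[ γ i ℕ.+ y ≈ 0 ]) (λ x≈y → 𝟙-congˡ (+-cong ≈-refl x≈y)) i) ⟨
    ∑² K (λ i j → 𝟙[ γ i ℕ.+ γ j ℕ.* γ i ≈ 0 ])
      ≡⟨ ∑²-cong K (λ i j → cancel-γ i (γ j)) ⟩
    ∑² K (λ _ j → 𝟙[ γ j ℕ.+ 1 ≈ 0 ])
      ≡⟨ ∑-const K _ ⟩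
    + K * (∑[ j < K ] 𝟙[ γ j ℕ.+ 1 ≈ 0 ])
      ≡⟨ cong (+ K *_) (trans (∑-cong K (λ j → 𝟙-+1≈0 (γ j))) (∑Γ-𝟙 half<p∸1)) ⟩
    + K * 𝟙 (d ∣? half)
      ≡⟨ cong (+ K *_) (𝟙-⇔ (d ∣? half) ((2 ℕ.* d) ∣? (p ∸ 1)) (proj₂ (2d∣p∸1⇔d∣half d))
                                                                (proj₁ (2d∣p∸1⇔d∣half d))) ⟩
    + K * δα p g d ∎
    where
    open ≡-Reasoning
    factor : ∀ a b → a ℕ.+ b ℕ.* a ≡ a ℕ.* (b ℕ.+ 1)
    factor = ℕ-solve-∀
    cancel-γ : ∀ i y → 𝟙[ γ i ℕ.+ y ℕ.* γ i ≈ 0 ] ≡ 𝟙[ y ℕ.+ 1 ≈ 0 ]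
    cancel-γ i y = trans (cong (λ t → 𝟙[ t ≈ 0 ]) (factor (γ i) y))
                         (trans (𝟙-congʳ (≡⇒≈ (sym (ℕ.*-zeroʳ (γ i))))) (𝟙-*-cancelˡ (γ i) (g^-≉0 (d ℕ.* i))))

  energy-B : energy ≡ + K * (+ K * δα p g d + sumNℤ p g d (λ l → c0 p g d 0 l ℕ.^ 2) d)
  energy-B = begin
    energy                                ≡⟨ trans energy≡∑R² ∑R²-split ⟩
    R 0 * R 0 + + K * ΣR²                 ≡⟨ cong₂ (λ u v → u * u + + K * v) R-0 (sym (sumNℤ-squares c0≡R)) ⟩
    + K * δ * (+ K * δ) + + K * Σc²
      ≡⟨ cong (_+ + K * Σc²) (trans (regroup (+ K) δ) (cong (λ t → + K * (+ K * t)) (𝟙-idem _))) ⟩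
    + K * (+ K * δ) + + K * Σc²           ≡⟨ *-distribˡ-+ (+ K) _ _ ⟨
    + K * (+ K * δ + Σc²)                 ∎
    where
    open ≡-Reasoning
    δ = δα p g d
    ΣR² = ∑[ l < d ] R (g ^ l) * R (g ^ l)
    Σc² = sumNℤ p g d (λ l → c0 p g d 0 l ℕ.^ 2) d
    c0≡R : ∀ l → + c0 p g d 0 l ≡ R (g ^ l)
    c0≡R l = trans (c0≡∑² 0 l) (∑²-cong K (λ i j → cong (λ t → 𝟙[ γ i ℕ.+ t ≈ g ^ l ]) (ℕ.*-identityˡ (γ j))))
    regroup : ∀ k δ → k * δ * (k * δ) ≡ k * (k * (δ * δ))
    regroup = solve-∀

  -- Formula (a): the energy through the cyclotomic numbers c₀,l,0

  triples : ℤ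
  triples = ∑[ x < K ] ∑[ y < K ] ∑[ z < K ] 𝟙[ γ x ℕ.+ γ y ≈ 1 ℕ.+ γ z ]

  energy≡K*triples : energy ≡ + K * triples
  energy≡K*triples =
    trans (∑-comm K K (λ j₁ j₂ → ∑[ j₃ < K ] ∑[ j₄ < K ] 𝟙[ γ j₁ ℕ.+ γ j₃ ≈ γ j₂ ℕ.+ γ j₄ ]))
          (trans (∑-cong K scaled) (∑-const K triples))
    where
    open ≡-Reasoning
    factor₁ : ∀ x y b → x ℕ.* b ℕ.+ y ℕ.* b ≡ b ℕ.* (x ℕ.+ y)
    factor₁ = ℕ-solve-∀
    factor₂ : ∀ z b → b ℕ.+ z ℕ.* b ≡ b ℕ.* (1 ℕ.+ z)
    factor₂ = ℕ-solve-∀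
    -- dividing by γ_b turns γ_b + γ_z into 1 + γ_z
    scaled : ∀ b → ∑[ x < K ] ∑[ y < K ] ∑[ z < K ] 𝟙[ γ x ℕ.+ γ y ≈ γ b ℕ.+ γ z ] ≡ triples
    scaled b = begin
      ∑[ x < K ] ∑[ y < K ] ∑[ z < K ] 𝟙[ γ x ℕ.+ γ y ≈ γ b ℕ.+ γ z ]
        ≡⟨ ∑Γ-* (λ u → ∑[ y < K ] ∑[ z < K ] 𝟙[ u ℕ.+ γ y ≈ γ b ℕ.+ γ z ])
                (λ e → ∑-cong K (λ _ → ∑-cong K (λ _ → 𝟙-congˡ (+-cong e ≈-refl)))) b ⟨
      ∑[ x < K ] ∑[ y < K ] ∑[ z < K ] 𝟙[ γ x ℕ.* γ b ℕ.+ γ y ≈ γ b ℕ.+ γ z ]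
        ≡⟨ ∑-cong K (λ x → ∑Γ-* (λ u → ∑[ z < K ] 𝟙[ γ x ℕ.* γ b ℕ.+ u ≈ γ b ℕ.+ γ z ])
                                (λ e → ∑-cong K (λ _ → 𝟙-congˡ (+-cong ≈-refl e))) b) ⟨
      ∑[ x < K ] ∑[ y < K ] ∑[ z < K ] 𝟙[ γ x ℕ.* γ b ℕ.+ γ y ℕ.* γ b ≈ γ b ℕ.+ γ z ]
        ≡⟨ ∑-cong K (λ x → ∑-cong K (λ y → ∑Γ-* (λ u → 𝟙[ γ x ℕ.* γ b ℕ.+ γ y ℕ.* γ b ≈ γ b ℕ.+ u ])
                                                (λ e → 𝟙-congʳ (+-cong ≈-refl e)) b)) ⟨
      ∑[ x < K ] ∑[ y < K ] ∑[ z < K ] 𝟙[ γ x ℕ.* γ b ℕ.+ γ y ℕ.* γ b ≈ γ b ℕ.+ γ z ℕ.* γ b ]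
        ≡⟨ ∑-cong K (λ x → ∑-cong K (λ y → ∑-cong K (λ z →
             trans (cong₂ 𝟙[_≈_] (factor₁ (γ x) (γ y) (γ b)) (factor₂ (γ z) (γ b)))
                   (𝟙-*-cancelˡ (γ b) (g^-≉0 (d ℕ.* b)))))) ⟩
      triples ∎

  twisted : ℤ
  twisted = ∑[ x < K ] ∑[ y < K ] ∑[ m < K ] 𝟙[ γ x ℕ.+ γ y ≈ 1 ℕ.+ γ m ℕ.* γ y ]

  triples≡twisted : triples ≡ twisted
  triples≡twisted = ∑-cong K λ x → ∑-cong K λ y →
    sym (∑Γ-* (λ u → 𝟙[ γ x ℕ.+ γ y ≈ 1 ℕ.+ u ]) (λ e → 𝟙-congʳ (+-cong (≈-refl {1}) e)) y)

  c₀ : ℕ → ℤ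
  c₀ l = ∑² K (λ i j → 𝟙[ γ i ℕ.+ g ^ l ℕ.* γ j ≈ 1 ])

  Φ : ℕ → ℕ → ℕ → ℤ
  Φ i i′ w = ∑[ m < K ] 𝟙[ γ i ℕ.+ w ≈ 1 ] * 𝟙[ γ i′ ℕ.+ w ℕ.* γ m ≈ 1 ]

  Φ-cong : ∀ i i′ {w w′} → w ≈ w′ → Φ i i′ w ≡ Φ i i′ w′
  Φ-cong i i′ w≈w′ = ∑-cong K (λ m → cong₂ _*_ (𝟙-congˡ (+-cong (≈-refl {γ i}) w≈w′))
                                                (𝟙-congˡ (+-cong (≈-refl {γ i′}) (*-cong w≈w′ (≈-refl {γ m})))))

  ∑c₀-pairs : ∀ l i i′ j →
              ∑[ j′ < K ] 𝟙[ γ i ℕ.+ g ^ l ℕ.* γ j ≈ 1 ] * 𝟙[ γ i′ ℕ.+ g ^ l ℕ.* γ j′ ≈ 1 ] ≡ Φ i i′ (coset l j)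
  ∑c₀-pairs l i i′ j = trans
    (sym (∑Γ-* (λ u → 𝟙[ γ i ℕ.+ g ^ l ℕ.* γ j ≈ 1 ] * 𝟙[ γ i′ ℕ.+ g ^ l ℕ.* u ≈ 1 ])
               (λ e → cong (𝟙[ γ i ℕ.+ g ^ l ℕ.* γ j ≈ 1 ] *_) (𝟙-congˡ (+-cong (≈-refl {γ i′}) (*-cong (≈-refl {g ^ l}) e)))) j))
    (∑-cong K (λ m → cong₂ (λ u v → 𝟙[ γ i ℕ.+ u ≈ 1 ] * 𝟙[ γ i′ ℕ.+ v ≈ 1 ]) g^l*γj≡coset (reassociate m)))
    where
    g^l*γj≡coset : g ^ l ℕ.* γ j ≡ coset l j
    g^l*γj≡coset = trans (ℕ.*-comm (g ^ l) (γ j)) (sym (coset≡γ* l j))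
    reassociate : ∀ m → g ^ l ℕ.* (γ m ℕ.* γ j) ≡ coset l j ℕ.* γ m
    reassociate m = trans (cong (g ^ l ℕ.*_) (ℕ.*-comm (γ m) (γ j)))
                          (trans (sym (ℕ.*-assoc (g ^ l) (γ j) (γ m))) (cong (ℕ._* γ m) g^l*γj≡coset))

  Φ-0 : ∀ i i′ → Φ i i′ 0 ≡ + K * (𝟙[ γ i ≈ 1 ] * 𝟙[ γ i′ ≈ 1 ])
  Φ-0 i i′ = trans (∑-cong K (λ _ → cong₂ _*_ (cong (λ t → 𝟙[ t ≈ 1 ]) (ℕ.+-identityʳ (γ i)))
                                               (cong (λ t → 𝟙[ t ≈ 1 ]) (ℕ.+-identityʳ (γ i′)))))
                   (∑-const K _)

  twistedSlice : ℕ → ℕ → ℤ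
  twistedSlice i i′ = ∑[ m < K ] 𝟙[ γ i′ ℕ.+ γ m ≈ 1 ℕ.+ γ i ℕ.* γ m ]

  ∑²-twistedSlice : ∑² K twistedSlice ≡ twisted
  ∑²-twistedSlice = trans (∑-comm K K twistedSlice)
                          (∑-cong K (λ i′ → ∑-comm K K (λ i m → 𝟙[ γ i′ ℕ.+ γ m ≈ 1 ℕ.+ γ i ℕ.* γ m ])))

  ∑-Φ : ∀ i i′ → ∑[ w < p ] Φ i i′ w ≡ twistedSlice i i′
  ∑-Φ i i′ = trans (∑-comm p K _) (∑-cong K λ m → begin
    ∑[ w < p ] 𝟙[ γ i ℕ.+ w ≈ 1 ] * 𝟙[ γ i′ ℕ.+ w ℕ.* γ m ≈ 1 ]
      ≡⟨ ∑-cong p (λ w → cong (_* 𝟙[ γ i′ ℕ.+ w ℕ.* γ m ≈ 1 ]) (𝟙-+-solve (γ i) w 1)) ⟩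
    ∑[ w < p ] 𝟙[ u ≈ w ] * 𝟙[ γ i′ ℕ.+ w ℕ.* γ m ≈ 1 ]
      ≡⟨ ∑-𝟙-sift u (λ w → 𝟙[ γ i′ ℕ.+ w ℕ.* γ m ≈ 1 ]) ⟩
    𝟙[ γ i′ ℕ.+ u % p ℕ.* γ m ≈ 1 ]
      ≡⟨ 𝟙-congˡ (+-cong (≈-refl {γ i′}) (*-cong (%-≈ u) (≈-refl {γ m}))) ⟩
    𝟙[ γ i′ ℕ.+ u ℕ.* γ m ≈ 1 ]
      ≡⟨ 𝟙-≈-⇔ (λ e → ≈-trans (≈-sym (shifted m)) (+-cong e (≈-refl {γ i ℕ.* γ m})))
               (λ e → +-cancelʳ (γ i ℕ.* γ m) (≈-trans (shifted m) e)) ⟩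
    𝟙[ γ i′ ℕ.+ γ m ≈ 1 ℕ.+ γ i ℕ.* γ m ] ∎)
    where
    open ≡-Reasoning
    u = 1 ℕ.+ negate (γ i)
    rearrange : ∀ x n y z → (x ℕ.+ (1 ℕ.+ n) ℕ.* z) ℕ.+ y ℕ.* z ≡ (x ℕ.+ z) ℕ.+ (n ℕ.+ y) ℕ.* z
    rearrange = ℕ-solve-∀
    shifted : ∀ m → (γ i′ ℕ.+ u ℕ.* γ m) ℕ.+ γ i ℕ.* γ m ≈ γ i′ ℕ.+ γ m
    shifted m = ≈-trans (≡⇒≈ (rearrange (γ i′) (negate (γ i)) (γ i) (γ m)))
                        (+-≈0ʳ (*-cong (negate-inverse (γ i)) (≈-refl {γ m})))

  ∑Φ-units : ∀ i i′ → ∑[ l < d ] ∑[ j < K ] Φ i i′ (coset l j) ≡ twistedSlice i i′ - + K * (𝟙[ γ i ≈ 1 ] * 𝟙[ γ i′ ≈ 1 ])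
  ∑Φ-units i i′ = begin
    ∑[ l < d ] ∑[ j < K ] Φ i i′ (coset l j)              ≡⟨ ∑-units-by-cosets (Φ i i′) (Φ-cong i i′) ⟨
    ∑[ u < p ∸ 1 ] Φ i i′ (suc u)                         ≡⟨ add-sub _ (Φ i i′ 0) ⟩
    Φ i i′ 0 + ∑[ u < p ∸ 1 ] Φ i i′ (suc u) - Φ i i′ 0   ≡⟨ cong (_- Φ i i′ 0) (∑-0+units (Φ i i′)) ⟨
    ∑[ w < p ] Φ i i′ w - Φ i i′ 0                        ≡⟨ cong₂ _-_ (∑-Φ i i′) (Φ-0 i i′) ⟩
    twistedSlice i i′ - + K * (𝟙[ γ i ≈ 1 ] * 𝟙[ γ i′ ≈ 1 ]) ∎
    where
    open ≡-Reasoning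
    add-sub : ∀ x y → x ≡ (y + x) - y
    add-sub = solve-∀

  ∑²-𝟙≈1 : ∑² K (λ i i′ → + K * (𝟙[ γ i ≈ 1 ] * 𝟙[ γ i′ ≈ 1 ])) ≡ + K
  ∑²-𝟙≈1 = begin
    ∑² K (λ i i′ → + K * (𝟙[ γ i ≈ 1 ] * 𝟙[ γ i′ ≈ 1 ]))          ≡⟨ ∑²-cong K (λ i i′ → *-assoc (+ K) _ _) ⟨
    ∑² K (λ i i′ → + K * 𝟙[ γ i ≈ 1 ] * 𝟙[ γ i′ ≈ 1 ])            ≡⟨ ∑²-product K _ _ ⟩
    (∑[ i < K ] + K * 𝟙[ γ i ≈ 1 ]) * (∑[ i′ < K ] 𝟙[ γ i′ ≈ 1 ])  ≡⟨ cong₂ _*_ (trans (∑-*ˡ K (+ K) _) (cong (+ K *_) ∑Γ-𝟙-1)) ∑Γ-𝟙-1 ⟩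
    + K * + 1 * + 1                                               ≡⟨ trans (*-identityʳ _) (*-identityʳ (+ K)) ⟩
    + K                                                           ∎
    where open ≡-Reasoning

  -- In c₀,l,0², w = g^l γ_j runs over all units once as (l, j) varies; summing over all residues
  -- instead, γ_i + w ≡ 1 pins down w, and the extra w = 0 term is K [γ_i ≡ γ_i′ ≡ 1].
  ∑c₀²≡twisted-K : ∑[ l < d ] c₀ l * c₀ l ≡ twisted - + K
  ∑c₀²≡twisted-K = begin
    ∑[ l < d ] c₀ l * c₀ l
      ≡⟨ ∑-cong d (λ l → sym (∑⁴-product K (X l) (X l))) ⟩
    ∑[ l < d ] ∑⁴ K (λ i i′ j j′ → X l i j * X l i′ j′)
      ≡⟨ trans (∑-comm d K _) (∑-cong K (λ i → ∑-comm d K _)) ⟩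
    ∑² K (λ i i′ → ∑[ l < d ] ∑[ j < K ] ∑[ j′ < K ] X l i j * X l i′ j′)
      ≡⟨ ∑²-cong K (λ i i′ → trans (∑-cong d (λ l → ∑-cong K (∑c₀-pairs l i i′))) (∑Φ-units i i′)) ⟩
    ∑² K (λ i i′ → twistedSlice i i′ - + K * (𝟙[ γ i ≈ 1 ] * 𝟙[ γ i′ ≈ 1 ]))
      ≡⟨ trans (∑-cong K (λ i → ∑-distrib-- K _ _)) (∑-distrib-- K _ _) ⟩
    ∑² K twistedSlice - ∑² K (λ i i′ → + K * (𝟙[ γ i ≈ 1 ] * 𝟙[ γ i′ ≈ 1 ]))
      ≡⟨ cong₂ _-_ ∑²-twistedSlice ∑²-𝟙≈1 ⟩
    twisted - + K ∎
    where
    open ≡-Reasoning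
    X : ℕ → ℕ → ℕ → ℤ
    X l i j = 𝟙[ γ i ℕ.+ g ^ l ℕ.* γ j ≈ 1 ]

  energy-A : energy ≡ + K * (+ K + sumNℤ p g d (λ l → c0 p g d l 0 ℕ.^ 2) d)
  energy-A = begin
    energy                                    ≡⟨ trans energy≡K*triples (cong (+ K *_) triples≡twisted) ⟩
    + K * twisted                             ≡⟨ cong (+ K *_) (sub-add twisted (+ K)) ⟩
    + K * (+ K + (twisted - + K))             ≡⟨ cong (λ t → + K * (+ K + t)) ∑c₀²≡twisted-K ⟨
    + K * (+ K + ∑[ l < d ] c₀ l * c₀ l)       ≡⟨ cong (λ t → + K * (+ K + t)) (sumNℤ-squares (λ l → c0≡∑² l 0)) ⟨
    + K * (+ K + sumNℤ p g d (λ l → c0 p g d l 0 ℕ.^ 2) d) ∎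
    where
    open ≡-Reasoning
    sub-add : ∀ x y → x ≡ y + (x - y)
    sub-add = solve-∀

lemma4p1 : (p g d : ℕ) .{{_ : NonZero p}} .{{_ : NonZero d}} →
    Prime p → p ≢ 2 → IsPrimitiveRoot p g → d ∣ p ∸ 1 →
    _≈C_ p (V4 p g d) (constC p (rhsA p g d)) ×
    _≈C_ p (V4 p g d) (constC p (rhsB p g d))
lemma4p1 p g d p-prime p≢2 primRoot d∣p∸1 =
    V4-≈C-energy _ (rhsA p g d) energy-A (distribute (+ p) (+ K) _ _)
  , V4-≈C-energy _ (rhsB p g d) energy-B (distribute-assoc (+ p) (+ K) (δα p g d) _ _)
  where
  open GaussPeriods p g d p-prime p≢2 primRoot d∣p∸1
  distribute : ∀ P K S c → P * (K + S) - c ≡ P * K + P * S - c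
  distribute = solve-∀
  distribute-assoc : ∀ P K δ S c → P * (K * δ + S) - c ≡ P * K * δ + P * S - c
  distribute-assoc = solve-∀
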